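{- Fix $d\ge 1$ and let $f(x)=\sum_{n\ge0} a_d(n)x^n$, where $a_d(n)$ is the number of (structurally different) boundary guillotine partitions of a $d$-dimensional box by $n$ cuts. Define power series $G_d=1$ and, for $i=d-1,d-2,\dots,0$, $$G_i = 1+\frac{(d-i)\,x(1-x)}{(1-(i+1)x)^2}\,G_{i+1}^2 .$$ Then $f=G_0$; that is, $$f = 1 + \frac{dx(1-x)}{(1-x)^2}\left( 1 + \frac{(d-1)x(1-x)}{(1-2x)^2} \left(\cdots \left( 1 + \frac{2x(1-x)}{(1-(d-1)x)^2}\left( 1 + \frac{x(1-x)}{(1-dx)^2} \right)^2\right)^2 \cdots \right)^2 \right)^2.$$
   Context: Guillotine partitions: Let $B$ be an axis-parallel box in $\mathbb{R}^d$. A partition of $B$ is a set $S$ of $k>0$ interior-disjoint axis-parallel boxes whose union is $B$. $S$ is a guillotine partition if $k=1$, or there are a hyperplane $h$ (orthogonal to some axis $x_i$) and disjoint nonempty $S^-,S^+\subset S$ such that $h$ splits $B$ into interior-disjoint boxes $B^-$ (below $h$) and $B^+$ (above $h$), with $S^\pm$ a guillotine partition of $B^\pm$; the boxes arising at recursive stages are subboxes. A cut is the intersection of such a splitting hyperplane with the subbox it splits; it is a $(d-1)$-dimensional axis-parallel box. Structure is recorded by a colored binary tree: trivial partition gives the empty tree; otherwise take the highest splitting hyperplane of $B$ (all are orthogonal to a common axis $x_i$), color the root $i$, and let the left/right subtrees be the trees of $B^-$/$B^+$. Partitions with the same tree are structurally identical and counted once; the number of cuts is the number of vertices. A guillotine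 partition is a boundary guillotine partition if for every cut, each of its $d-1$ pairs of opposite $(d-2)$-dimensional faces contains at least one face lying in the boundary of $B$. -}

module Defs where

open import Data.Nat as ℕ using (ℕ; zero; suc; _∸_)
open import Data.Integer as ℤ using (ℤ; +_; -_)
open import Data.Rational as ℚ using (ℚ)
open import Data.Rational.Properties using (_≤?_)
open import Data.Fin using (Fin)
open import Data.Vec using (Vec; lookup; _[_]≔_)
open import Data.List using (List; []; _∷_; filter; map; upTo; length)
open import Data.List.Relation.Unary.All using (All)
open import Data.List.Relation.Unary.Unique.Propositional using (Unique)
open import Data.List.Membership.Propositional using (_∈_)
open import Data.Product using (Σ; _×_; _,_; proj₁; proj₂)
open import Data.Sum using (_⊎_)
open import Data.Unit using (⊤)
open import Function.Bundles using (_⇔_)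
open import Relation.Binary.PropositionalEquality using (_≡_; _≢_)

Box : ℕ → Set
Box d = Vec (ℚ × ℚ) d

lo hi : ∀ {d} → Box d → Fin d → ℚ
lo B j = proj₁ (lookup B j)
hi B j = proj₂ (lookup B j)

ValidBox : ∀ {d} → Box d → Set
ValidBox B = ∀ j → lo B j ℚ.< hi B j

lowerPart upperPart : ∀ {d} → Box d → Fin d → ℚ → Box d
lowerPart B i c = B [ i ]≔ (lo B i , c)
upperPart B i c = B [ i ]≔ (c , hi B i)

below above : ∀ {d} → Fin d → ℚ → List (Box d) → List (Box d)
below i c S = filter (λ b → hi b i ≤? c) S
above i c S = filter (λ b → c ≤? lo b i) S

OneSide : ∀ {d} → Fin d → ℚ → List (Box d) → Set
OneSide i c S = All (λ b → (hi b i ℚ.≤ c) ⊎ (c ℚ.≤ lo b i)) S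

data IsGuillotine {d : ℕ} (B : Box d) (S : List (Box d)) : Set where
  trivial : S ≡ B ∷ [] → IsGuillotine B S
  split   : (i : Fin d) (c : ℚ) →
            lo B i ℚ.< c → c ℚ.< hi B i → OneSide i c S →
            IsGuillotine (lowerPart B i c) (below i c S) →
            IsGuillotine (upperPart B i c) (above i c S) →
            IsGuillotine B S

Splitting : ∀ {d} → Box d → List (Box d) → Fin d → ℚ → Set
Splitting B S i c =
  (lo B i ℚ.< c) × (c ℚ.< hi B i) × OneSide i c S ×
  IsGuillotine (lowerPart B i c) (below i c S) ×
  IsGuillotine (upperPart B i c) (above i c S)

-- Colored binary trees (colors = axes 1..d, here Fin d)

data Tree (d : ℕ) : Set where
  leaf : Tree d
  node : Fin d → Tree d → Tree d → Tree d

-- number of vertices = number of cuts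
size : ∀ {d} → Tree d → ℕ
size leaf         = 0
size (node _ l r) = suc (size l ℕ.+ size r)

-- Trivial partition ↦ empty tree; otherwise the root is colored by the
-- axis i of the highest splitting hyperplane x_i = c (all splitting
-- hyperplanes being orthogonal to x_i), left/right subtrees are the trees
-- of B⁻ / B⁺.
data TreeOf {d : ℕ} (B : Box d) (S : List (Box d)) : Tree d → Set where
  leafT : S ≡ B ∷ [] → TreeOf B S leaf
  nodeT : ∀ {T⁻ T⁺} (i : Fin d) (c : ℚ) →
          Splitting B S i c →
          (∀ j c′ → Splitting B S j c′ → (j ≡ i) × (c′ ℚ.≤ c)) →
          TreeOf (lowerPart B i c) (below i c S) T⁻ →
          TreeOf (upperPart B i c) (above i c S) T⁺ →
          TreeOf B S (node i T⁻ T⁺)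

-- Boundary condition: every cut (made in a subbox C, orthogonal to x_i)
-- has, for each axis j ≠ i, one of its two (d-2)-faces orthogonal to x_j
-- in the boundary of the outer box B₀, i.e. C touches the lower or the
-- upper facet of B₀ in direction j.
BoundaryCuts : ∀ {d} (B₀ : Box d) {B : Box d} {S : List (Box d)} {T : Tree d} →
               TreeOf B S T → Set
BoundaryCuts B₀ (leafT _) = ⊤
BoundaryCuts B₀ {B} (nodeT i c _ _ p⁻ p⁺) =
  (∀ j → j ≢ i → (lo B j ≡ lo B₀ j) ⊎ (hi B j ≡ hi B₀ j)) ×
  BoundaryCuts B₀ p⁻ × BoundaryCuts B₀ p⁺

RealizedBoundary : (d n : ℕ) → Tree d → Set
RealizedBoundary d n T =
  Σ (Box d) (λ B → ValidBox B ×
    Σ (List (Box d)) (λ S → Σ (TreeOf B S T) (BoundaryCuts B))) ×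
  (size T ≡ n)

BoundaryCount : (d n : ℕ) → ℕ → Set
BoundaryCount d n m =
  Σ (List (Tree d)) λ L →
    Unique L × (∀ T → (T ∈ L) ⇔ RealizedBoundary d n T) × (length L ≡ m)

Series : Set
Series = ℕ → ℤ

one : Series
one zero    = + 1
one (suc _) = + 0

_⊕_ : Series → Series → Series
(f ⊕ g) n = f n ℤ.+ g n

_·_ : ℤ → Series → Series
(a · f) n = a ℤ.* f n

sumℤ : List ℤ → ℤ
sumℤ []       = + 0
sumℤ (x ∷ xs) = x ℤ.+ sumℤ xs

_⊛_ : Series → Series → Series
(f ⊛ g) n = sumℤ (map (λ k → f k ℤ.* g (n ∸ k)) (upTo (suc n)))

xOneMinusX : Series
xOneMinusX 1 = + 1
xOneMinusX 2 = - (+ 1)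
xOneMinusX _ = + 0

-- 1/(1 - c x) = Σ c^k x^k  (the inverse of 1 - c x in ℤ[[x]])
invOneMinus : ℕ → Series
invOneMinus c k = + (c ℕ.^ k)

invOneMinusSq : ℕ → Series
invOneMinusSq c = invOneMinus c ⊛ invOneMinus c

-- H d m = G_{d-m}:  H d 0 = G_d = 1, and with i = d-(m+1),
-- G_i = 1 + (d-i) x(1-x)/(1-(i+1)x)² · G_{i+1}²,  d-i = m+1, i+1 = d-m.
H : ℕ → ℕ → Series
H d zero    = one
H d (suc m) =
  one ⊕ ((+ suc m) · ((xOneMinusX ⊛ invOneMinusSq (d ∸ m)) ⊛ (H d m ⊛ H d m)))

G₀ : ℕ → Series
G₀ d = H d d

-- A coloured tree is the tree of a boundary guillotine partition exactly when it is
-- admissible: every cut orthogonal to x_i lies in a subbox that, in each other axis j,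
-- touches the lower or the upper facet of the outer box, and the upper part of a cut
-- orthogonal to x_i is not itself first cut along x_i (that cut would be a higher splitting
-- hyperplane).  Every admissible tree is realized by putting its cuts at integer positions.
--
-- Admissible trees are enumerated while recording which facets the current subbox touches.
-- Their number depends only on the number r of axes in which both facets are touched, and
-- the generating functions U_r of these numbers satisfy U_0 = 1/(1 - dx) and
--   (1 - (d-r-1)x) U_{r+1} = 1 + (r+1) x (1-x) U_r²:
-- a cut along a doubly touched axis leaves r such axes on both sides, the factor 1 - x
-- excluding an upper part that is first cut along the same axis.  Hence H_m = (1-(d-m)x) U_m
-- obeys the recursion of G_{d-m}, and f = U_d = H_d = G_0.

module Submission where

open import Defs

module PowerSeries where

  open import Data.Nat as ℕ using (ℕ; zero; suc)
  open import Data.Integer using (ℤ; +_; -_; _+_; _*_; _-_)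
  import Data.Integer.Properties as ℤₚ
  open import Data.Integer.Tactic.RingSolver using (solve-∀)
  open import Data.List using (applyUpTo)
  open import Data.List.Properties using (map-applyUpTo)
  open import Function using (id; const)
  open import Relation.Binary.PropositionalEquality
  import Relation.Binary.Reasoning.Setoid as SetoidReasoning

  tail : Series → Series
  tail f n = f (suc n)

  infixl 7 _⋆_

  _⋆_ : Series → Series → Series
  (f ⋆ g) zero    = f 0 * g 0
  (f ⋆ g) (suc n) = f 0 * g (suc n) + (tail f ⋆ g) n

  ⊛≗⋆ : ∀ f g → f ⊛ g ≗ f ⋆ g
  ⊛≗⋆ f g n = trans (cong sumℤ (map-applyUpTo id (λ k → f k * g (n ℕ.∸ k)) (suc n))) (sum≡⋆ f n)
    where
    sum≡⋆ : ∀ f n → sumℤ (applyUpTo (λ k → f k * g (n ℕ.∸ k)) (suc n)) ≡ (f ⋆ g) n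
    sum≡⋆ f zero    = ℤₚ.+-identityʳ _
    sum≡⋆ f (suc n) = cong (λ z → f 0 * g (suc n) + z) (sum≡⋆ (tail f) n)

  ⋆-cong : ∀ {f f′ g g′} → f ≗ f′ → g ≗ g′ → f ⋆ g ≗ f′ ⋆ g′
  ⋆-cong f≗ g≗ zero    = cong₂ _*_ (f≗ 0) (g≗ 0)
  ⋆-cong f≗ g≗ (suc n) =
    cong₂ _+_ (cong₂ _*_ (f≗ 0) (g≗ (suc n))) (⋆-cong (λ k → f≗ (suc k)) g≗ n)

  ⋆-congˡ : ∀ {f f′} g → f ≗ f′ → f ⋆ g ≗ f′ ⋆ g
  ⋆-congˡ g f≗ = ⋆-cong f≗ (λ _ → refl)

  ⋆-congʳ : ∀ f {g g′} → g ≗ g′ → f ⋆ g ≗ f ⋆ g′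
  ⋆-congʳ f g≗ = ⋆-cong {f = f} (λ _ → refl) g≗

  ⋆-sucʳ : ∀ f g n → (f ⋆ g) (suc n) ≡ g 0 * f (suc n) + (f ⋆ tail g) n
  ⋆-sucʳ f g zero    = base (f 0) (f 1) (g 0) (g 1)
    where
    base : ∀ a b c e → a * e + b * c ≡ c * b + a * e
    base = solve-∀
  ⋆-sucʳ f g (suc n) rewrite ⋆-sucʳ (tail f) g n =
    swap (f 0 * g (suc (suc n))) (g 0 * f (suc (suc n))) ((tail f ⋆ tail g) n)
    where
    swap : ∀ a b c → a + (b + c) ≡ b + (a + c)
    swap = solve-∀

  ⋆-comm : ∀ f g → f ⋆ g ≗ g ⋆ f
  ⋆-comm f g zero    = ℤₚ.*-comm (f 0) (g 0)
  ⋆-comm f g (suc n) =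
    trans (cong (λ z → f 0 * g (suc n) + z) (⋆-comm (tail f) g n)) (sym (⋆-sucʳ g f n))

  ⋆-zeroˡ : ∀ {f} g → f ≗ const (+ 0) → f ⋆ g ≗ const (+ 0)
  ⋆-zeroˡ g f≗0 zero    = cong (_* g 0) (f≗0 0)
  ⋆-zeroˡ g f≗0 (suc n) =
    cong₂ _+_ (cong (_* g (suc n)) (f≗0 0)) (⋆-zeroˡ g (λ k → f≗0 (suc k)) n)

  ⋆-identityˡ : ∀ g → one ⋆ g ≗ g
  ⋆-identityˡ g zero    = ℤₚ.*-identityˡ (g 0)
  ⋆-identityˡ g (suc n) = begin
    + 1 * g (suc n) + (tail one ⋆ g) n ≡⟨ cong₂ _+_ (ℤₚ.*-identityˡ (g (suc n))) (⋆-zeroˡ g (λ _ → refl) n) ⟩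
    g (suc n) + + 0                    ≡⟨ ℤₚ.+-identityʳ (g (suc n)) ⟩
    g (suc n)                          ∎
    where open ≡-Reasoning

  ⋆-distribʳ-⊕ : ∀ f g h → (f ⊕ g) ⋆ h ≗ (f ⋆ h) ⊕ (g ⋆ h)
  ⋆-distribʳ-⊕ f g h zero    = ℤₚ.*-distribʳ-+ (h 0) (f 0) (g 0)
  ⋆-distribʳ-⊕ f g h (suc n) rewrite ⋆-distribʳ-⊕ (tail f) (tail g) h n =
    regroup (f 0) (g 0) (h (suc n)) ((tail f ⋆ h) n) ((tail g ⋆ h) n)
    where
    regroup : ∀ a b c x y → (a + b) * c + (x + y) ≡ (a * c + x) + (b * c + y)
    regroup = solve-∀

  ·-⋆-assoc : ∀ a f g → (a · f) ⋆ g ≗ a · (f ⋆ g)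
  ·-⋆-assoc a f g zero    = ℤₚ.*-assoc a (f 0) (g 0)
  ·-⋆-assoc a f g (suc n) rewrite ·-⋆-assoc a (tail f) g n =
    factor a (f 0) (g (suc n)) ((tail f ⋆ g) n)
    where
    factor : ∀ a b c x → a * b * c + a * x ≡ a * (b * c + x)
    factor = solve-∀

  -- tail (f ⋆ g) is definitionally (f 0 · tail g) ⊕ (tail f ⋆ g).
  ⋆-assoc : ∀ f g h → (f ⋆ g) ⋆ h ≗ f ⋆ (g ⋆ h)
  ⋆-assoc f g h zero    = ℤₚ.*-assoc (f 0) (g 0) (h 0)
  ⋆-assoc f g h (suc n) = begin
    f 0 * g 0 * h (suc n) + (((f 0 · tail g) ⊕ (tail f ⋆ g)) ⋆ h) n
      ≡⟨ cong (λ z → f 0 * g 0 * h (suc n) + z) (begin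
           (((f 0 · tail g) ⊕ (tail f ⋆ g)) ⋆ h) n
             ≡⟨ ⋆-distribʳ-⊕ (f 0 · tail g) (tail f ⋆ g) h n ⟩
           ((f 0 · tail g) ⋆ h) n + ((tail f ⋆ g) ⋆ h) n
             ≡⟨ cong₂ _+_ (·-⋆-assoc (f 0) (tail g) h n) (⋆-assoc (tail f) g h n) ⟩
           f 0 * (tail g ⋆ h) n + (tail f ⋆ (g ⋆ h)) n ∎) ⟩
    f 0 * g 0 * h (suc n) + (f 0 * (tail g ⋆ h) n + (tail f ⋆ (g ⋆ h)) n)
      ≡⟨ regroup (f 0) (g 0) (h (suc n)) ((tail g ⋆ h) n) ((tail f ⋆ (g ⋆ h)) n) ⟩
    f 0 * (g 0 * h (suc n) + (tail g ⋆ h) n) + (tail f ⋆ (g ⋆ h)) n ∎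
    where
    open ≡-Reasoning
    regroup : ∀ a b c x y → a * b * c + (a * x + y) ≡ a * (b * c + x) + y
    regroup = solve-∀

  module ≗-Reasoning = SetoidReasoning (ℕ →-setoid ℤ)

  ⋆-interchange : ∀ a b c e → (a ⋆ b) ⋆ (c ⋆ e) ≗ (a ⋆ c) ⋆ (b ⋆ e)
  ⋆-interchange a b c e = begin
    (a ⋆ b) ⋆ (c ⋆ e) ≈⟨ ⋆-assoc a b (c ⋆ e) ⟩
    a ⋆ (b ⋆ (c ⋆ e)) ≈⟨ ⋆-congʳ a (⋆-assoc b c e) ⟨
    a ⋆ ((b ⋆ c) ⋆ e) ≈⟨ ⋆-congʳ a (⋆-congˡ e (⋆-comm b c)) ⟩
    a ⋆ ((c ⋆ b) ⋆ e) ≈⟨ ⋆-congʳ a (⋆-assoc c b e) ⟩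
    a ⋆ (c ⋆ (b ⋆ e)) ≈⟨ ⋆-assoc a c (b ⋆ e) ⟨
    (a ⋆ c) ⋆ (b ⋆ e) ∎
    where open ≗-Reasoning

  X : Series
  X 1 = + 1
  X _ = + 0

  oneMinus : ℕ → Series
  oneMinus c 0 = + 1
  oneMinus c 1 = - (+ c)
  oneMinus c _ = + 0

  X⋆-zero : ∀ f → (X ⋆ f) 0 ≡ + 0
  X⋆-zero f = ℤₚ.*-zeroˡ (f 0)

  X⋆-suc : ∀ f n → (X ⋆ f) (suc n) ≡ f n
  X⋆-suc f n = begin
    + 0 * f (suc n) + (tail X ⋆ f) n ≡⟨ ℤₚ.+-identityˡ _ ⟩
    (tail X ⋆ f) n                   ≡⟨ ⋆-congˡ f tail-X n ⟩
    (one ⋆ f) n                      ≡⟨ ⋆-identityˡ f n ⟩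
    f n                              ∎
    where
    open ≡-Reasoning
    tail-X : tail X ≗ one
    tail-X zero    = refl
    tail-X (suc _) = refl

  oneMinus⋆-suc : ∀ c f n → (oneMinus c ⋆ f) (suc n) ≡ f (suc n) - + c * f n
  oneMinus⋆-suc c f n = begin
    + 1 * f (suc n) + (tail (oneMinus c) ⋆ f) n ≡⟨ cong₂ _+_ (ℤₚ.*-identityˡ (f (suc n))) (⋆-congˡ f tail-oneMinus n) ⟩
    f (suc n) + ((- + c) · one ⋆ f) n           ≡⟨ cong (λ z → f (suc n) + z) (·-⋆-assoc (- + c) one f n) ⟩
    f (suc n) + (- + c) * (one ⋆ f) n           ≡⟨ cong (λ z → f (suc n) + (- + c) * z) (⋆-identityˡ f n) ⟩
    f (suc n) + (- + c) * f n                   ≡⟨ cong (λ z → f (suc n) + z) (ℤₚ.neg-distribˡ-* (+ c) (f n)) ⟨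
    f (suc n) - + c * f n                       ∎
    where
    open ≡-Reasoning
    tail-oneMinus : tail (oneMinus c) ≗ (- + c) · one
    tail-oneMinus zero    = sym (ℤₚ.*-identityʳ _)
    tail-oneMinus (suc _) = sym (ℤₚ.*-zeroʳ (- + c))

  oneMinus⋆invOneMinus : ∀ c → oneMinus c ⋆ invOneMinus c ≗ one
  oneMinus⋆invOneMinus c zero    = refl
  oneMinus⋆invOneMinus c (suc n) = begin
    (oneMinus c ⋆ invOneMinus c) (suc n) ≡⟨ oneMinus⋆-suc c (invOneMinus c) n ⟩
    + (c ℕ.* c ℕ.^ n) - + c * + c ℕ.^ n  ≡⟨ cong (λ z → z - + c * + c ℕ.^ n) (ℤₚ.pos-* c (c ℕ.^ n)) ⟩
    + c * + c ℕ.^ n - + c * + c ℕ.^ n    ≡⟨ ℤₚ.+-inverseʳ (+ c * + c ℕ.^ n) ⟩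
    + 0                                  ∎
    where open ≡-Reasoning

  invOneMinus-cancel : ∀ c f → invOneMinus c ⋆ (oneMinus c ⋆ f) ≗ f
  invOneMinus-cancel c f = begin
    invOneMinus c ⋆ (oneMinus c ⋆ f) ≈⟨ ⋆-assoc (invOneMinus c) (oneMinus c) f ⟨
    (invOneMinus c ⋆ oneMinus c) ⋆ f ≈⟨ ⋆-congˡ f (⋆-comm (invOneMinus c) (oneMinus c)) ⟩
    (oneMinus c ⋆ invOneMinus c) ⋆ f ≈⟨ ⋆-congˡ f (oneMinus⋆invOneMinus c) ⟩
    one ⋆ f                          ≈⟨ ⋆-identityˡ f ⟩
    f                                ∎
    where open ≗-Reasoning

  invOneMinusSq-cancel : ∀ c f → (invOneMinus c ⋆ invOneMinus c) ⋆ ((oneMinus c ⋆ f) ⋆ (oneMinus c ⋆ f)) ≗ f ⋆ f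
  invOneMinusSq-cancel c f = begin
    (I ⋆ I) ⋆ (OF ⋆ OF) ≈⟨ ⋆-interchange I I OF OF ⟩
    (I ⋆ OF) ⋆ (I ⋆ OF) ≈⟨ ⋆-cong (invOneMinus-cancel c f) (invOneMinus-cancel c f) ⟩
    f ⋆ f               ∎
    where
    open ≗-Reasoning
    I OF : Series
    I  = invOneMinus c
    OF = oneMinus c ⋆ f

  xOneMinusX≗X⋆oneMinus1 : xOneMinusX ≗ X ⋆ oneMinus 1
  xOneMinusX≗X⋆oneMinus1 zero    = sym (X⋆-zero (oneMinus 1))
  xOneMinusX≗X⋆oneMinus1 (suc n) = trans (shift n) (sym (X⋆-suc (oneMinus 1) n))
    where
    shift : ∀ n → xOneMinusX (suc n) ≡ oneMinus 1 n
    shift 0       = refl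
    shift 1       = refl
    shift (suc (suc _)) = refl

open PowerSeries

module CountingSequence where

  open import Data.Nat as ℕ using (ℕ; zero; suc; _∸_; _≤_; _<_; z≤n; s≤s)
  import Data.Nat.Properties as ℕₚ
  open import Data.Integer as ℤ using (+_; _-_)
  import Data.Integer.Properties as ℤₚ
  open import Data.Integer.Tactic.RingSolver using (solve-∀)
  open import Function using (id; const; _∘_)
  import Data.Nat.ListAction as ℕᴸ
  open import Data.List using (map; upTo; applyUpTo)
  open import Data.List.Properties using (map-applyUpTo)
  open import Relation.Binary.PropositionalEquality

  infixl 7 _⋆ℕ_

  _⋆ℕ_ : (ℕ → ℕ) → (ℕ → ℕ) → ℕ → ℕ
  (f ⋆ℕ g) zero    = f 0 ℕ.* g 0
  (f ⋆ℕ g) (suc n) = f 0 ℕ.* g (suc n) ℕ.+ ((λ k → f (suc k)) ⋆ℕ g) n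

  ⋆ℕ-cong-≤ : ∀ n {f f′ g g′} → (∀ a → a ≤ n → f a ≡ f′ a) → (∀ b → b ≤ n → g b ≡ g′ b) →
              (f ⋆ℕ g) n ≡ (f′ ⋆ℕ g′) n
  ⋆ℕ-cong-≤ zero    f≡ g≡ = cong₂ ℕ._*_ (f≡ 0 z≤n) (g≡ 0 z≤n)
  ⋆ℕ-cong-≤ (suc n) f≡ g≡ = cong₂ ℕ._+_ (cong₂ ℕ._*_ (f≡ 0 z≤n) (g≡ (suc n) ℕₚ.≤-refl))
    (⋆ℕ-cong-≤ n (λ a a≤n → f≡ (suc a) (s≤s a≤n)) (λ b b≤n → g≡ b (ℕₚ.m≤n⇒m≤1+n b≤n)))

  sum-upTo≡⋆ℕ : ∀ f g n → ℕᴸ.sum (map (λ a → f a ℕ.* g (n ∸ a)) (upTo (suc n))) ≡ (f ⋆ℕ g) n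
  sum-upTo≡⋆ℕ f g n = trans (cong ℕᴸ.sum (map-applyUpTo id (λ a → f a ℕ.* g (n ∸ a)) (suc n))) (shifted f n)
    where
    shifted : ∀ f n → ℕᴸ.sum (applyUpTo (λ a → f a ℕ.* g (n ∸ a)) (suc n)) ≡ (f ⋆ℕ g) n
    shifted f zero    = ℕₚ.+-identityʳ _
    shifted f (suc n) = cong (f 0 ℕ.* g (suc n) ℕ.+_) (shifted (f ∘ suc) n)

  δ : ℕ → ℕ
  δ zero    = 1
  δ (suc _) = 0

  ⋆ℕ-δ : ∀ f n → (f ⋆ℕ δ) n ≡ f n
  ⋆ℕ-δ f zero    = ℕₚ.*-identityʳ (f 0)
  ⋆ℕ-δ f (suc n) =
    trans (cong (ℕ._+ ((λ k → f (suc k)) ⋆ℕ δ) n) (ℕₚ.*-zeroʳ (f 0))) (⋆ℕ-δ (λ k → f (suc k)) n)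

  Δ : (ℕ → ℕ) → ℕ → ℕ
  Δ u zero    = u zero
  Δ u (suc k) = u (suc k) ∸ u k

  const1⋆ℕΔ : ∀ {u} → (∀ k → u k ≤ u (suc k)) → ∀ n → (const 1 ⋆ℕ Δ u) n ≡ u n
  const1⋆ℕΔ u↑ zero    = ℕₚ.+-identityʳ _
  const1⋆ℕΔ u↑ (suc n) =
    trans (cong₂ ℕ._+_ (ℕₚ.*-identityˡ _) (const1⋆ℕΔ u↑ n)) (ℕₚ.m∸n+n≡m (u↑ n))

  toSeries : (ℕ → ℕ) → Series
  toSeries f n = + f n

  toSeries-⋆ℕ : ∀ f g → toSeries (f ⋆ℕ g) ≗ toSeries f ⋆ toSeries g
  toSeries-⋆ℕ f g zero    = ℤₚ.pos-* (f 0) (g 0)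
  toSeries-⋆ℕ f g (suc n) = trans (ℤₚ.pos-+ (f 0 ℕ.* g (suc n)) _)
    (cong₂ ℤ._+_ (ℤₚ.pos-* (f 0) (g (suc n))) (toSeries-⋆ℕ (λ k → f (suc k)) g n))

  toSeries-Δ : ∀ {u} → (∀ k → u k ≤ u (suc k)) → toSeries (Δ u) ≗ oneMinus 1 ⋆ toSeries u
  toSeries-Δ {u} u↑ zero    = sym (ℤₚ.*-identityˡ (+ u 0))
  toSeries-Δ {u} u↑ (suc k) = begin
    + (u (suc k) ∸ u k)      ≡⟨ ℤₚ.⊖-≥ (u↑ k) ⟨
    u (suc k) ℤ.⊖ u k        ≡⟨ ℤₚ.[+m]-[+n]≡m⊖n (u (suc k)) (u k) ⟨
    + u (suc k) - + u k      ≡⟨ cong (λ z → + u (suc k) - z) (ℤₚ.*-identityˡ (+ u k)) ⟨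
    + u (suc k) - + 1 ℤ.* + u k ≡⟨ oneMinus⋆-suc 1 (toSeries u) k ⟨
    (oneMinus 1 ⋆ toSeries u) (suc k) ∎
    where open ≡-Reasoning

  module _ (d : ℕ) where

    -- u r n counts the admissible trees with n cuts in a subbox touching both facets
    -- of the outer box in r axes and exactly one facet in the other d ∸ r axes.
    u : ℕ → ℕ → ℕ
    u zero    n       = d ℕ.^ n
    u (suc r) zero    = 1
    u (suc r) (suc n) = (d ∸ suc r) ℕ.* u (suc r) n ℕ.+ suc r ℕ.* (u r ⋆ℕ Δ (u r)) n

    u-zero : ∀ r → u r 0 ≡ 1
    u-zero zero    = refl
    u-zero (suc r) = refl

    u-mono : ∀ {r} → r < d → ∀ n → u r n ≤ u r (suc n)
    u-mono {zero}  0<d n = ℕₚ.m≤n*m (d ℕ.^ n) d {{ℕ.>-nonZero 0<d}}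
    u-mono {suc r} r<d n = ℕₚ.≤-trans
      (ℕₚ.m≤n*m (u (suc r) n) (d ∸ suc r) {{ℕ.>-nonZero (ℕₚ.m<n⇒0<n∸m r<d)}})
      (ℕₚ.m≤m+n _ _)

    u-suc : ∀ r n → r ℕ.* (u (r ∸ 1) ⋆ℕ Δ (u (r ∸ 1))) n ℕ.+ (d ∸ r) ℕ.* u r n ≡ u r (suc n)
    u-suc zero    n = refl
    u-suc (suc r) n = ℕₚ.+-comm (suc r ℕ.* (u r ⋆ℕ Δ (u r)) n) _

    U V : ℕ → Series
    U r = toSeries (u r)
    V r = toSeries (Δ (u r))

    oneMinus⋆U-suc : ∀ m → oneMinus (d ∸ suc m) ⋆ U (suc m) ≗ one ⊕ ((+ suc m) · (X ⋆ (U m ⋆ V m)))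
    oneMinus⋆U-suc m zero    = sym (begin
      + 1 ℤ.+ + suc m ℤ.* (X ⋆ (U m ⋆ V m)) 0 ≡⟨ cong (λ z → + 1 ℤ.+ + suc m ℤ.* z) (X⋆-zero (U m ⋆ V m)) ⟩
      + 1 ℤ.+ + suc m ℤ.* + 0                 ≡⟨ cong (λ z → + 1 ℤ.+ z) (ℤₚ.*-zeroʳ (+ suc m)) ⟩
      + 1                                     ∎)
      where open ≡-Reasoning
    oneMinus⋆U-suc m (suc k) = begin
      (oneMinus c ⋆ U (suc m)) (suc k)
        ≡⟨ oneMinus⋆-suc c (U (suc m)) k ⟩
      + (c ℕ.* u (suc m) k ℕ.+ suc m ℕ.* (u m ⋆ℕ Δ (u m)) k) - + c ℤ.* + u (suc m) k
        ≡⟨ cong (λ z → z - + c ℤ.* + u (suc m) k) (ℤₚ.pos-+ (c ℕ.* u (suc m) k) _) ⟩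
      + (c ℕ.* u (suc m) k) ℤ.+ + (suc m ℕ.* (u m ⋆ℕ Δ (u m)) k) - + c ℤ.* + u (suc m) k
        ≡⟨ cong₂ (λ y z → y ℤ.+ z - + c ℤ.* + u (suc m) k) (ℤₚ.pos-* c _) (ℤₚ.pos-* (suc m) _) ⟩
      + c ℤ.* + u (suc m) k ℤ.+ + suc m ℤ.* + (u m ⋆ℕ Δ (u m)) k - + c ℤ.* + u (suc m) k
        ≡⟨ cancel (+ c ℤ.* + u (suc m) k) (+ suc m ℤ.* + (u m ⋆ℕ Δ (u m)) k) ⟩
      + 0 ℤ.+ + suc m ℤ.* + (u m ⋆ℕ Δ (u m)) k
        ≡⟨ cong (λ z → + 0 ℤ.+ + suc m ℤ.* z) (toSeries-⋆ℕ (u m) (Δ (u m)) k) ⟩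
      + 0 ℤ.+ + suc m ℤ.* (U m ⋆ V m) k
        ≡⟨ cong (λ z → + 0 ℤ.+ + suc m ℤ.* z) (X⋆-suc (U m ⋆ V m) k) ⟨
      (one ⊕ ((+ suc m) · (X ⋆ (U m ⋆ V m)))) (suc k) ∎
      where
      open ≡-Reasoning
      c : ℕ
      c = d ∸ suc m
      cancel : ∀ a b → a ℤ.+ b - a ≡ + 0 ℤ.+ b
      cancel = solve-∀

    H≗oneMinus⋆U : ∀ {m} → m ≤ d → H d m ≗ oneMinus (d ∸ m) ⋆ U m
    H≗oneMinus⋆U {zero}  _   n = sym (oneMinus⋆invOneMinus d n)
    H≗oneMinus⋆U {suc m} m<d n =
      trans (cong (λ z → one n ℤ.+ + suc m ℤ.* z) (coefficient n)) (sym (oneMinus⋆U-suc m n))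
      where
      I Hm OU : Series
      I  = invOneMinus (d ∸ m)
      Hm = H d m
      OU = oneMinus (d ∸ m) ⋆ U m
      IH : Hm ≗ OU
      IH = H≗oneMinus⋆U (ℕₚ.<⇒≤ m<d)
      coefficient : (xOneMinusX ⊛ (I ⊛ I)) ⊛ (Hm ⊛ Hm) ≗ X ⋆ (U m ⋆ V m)
      coefficient = begin
        (xOneMinusX ⊛ (I ⊛ I)) ⊛ (Hm ⊛ Hm)
          ≈⟨ ⊛≗⋆ _ _ ⟩
        (xOneMinusX ⊛ (I ⊛ I)) ⋆ (Hm ⊛ Hm)
          ≈⟨ ⋆-cong (λ k → trans (⊛≗⋆ xOneMinusX (I ⊛ I) k) (⋆-congʳ xOneMinusX (⊛≗⋆ I I) k))
                    (⊛≗⋆ Hm Hm) ⟩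
        (xOneMinusX ⋆ (I ⋆ I)) ⋆ (Hm ⋆ Hm)
          ≈⟨ ⋆-congʳ (xOneMinusX ⋆ (I ⋆ I)) (⋆-cong IH IH) ⟩
        (xOneMinusX ⋆ (I ⋆ I)) ⋆ (OU ⋆ OU)
          ≈⟨ ⋆-assoc xOneMinusX (I ⋆ I) (OU ⋆ OU) ⟩
        xOneMinusX ⋆ ((I ⋆ I) ⋆ (OU ⋆ OU))
          ≈⟨ ⋆-congʳ xOneMinusX (invOneMinusSq-cancel (d ∸ m) (U m)) ⟩
        xOneMinusX ⋆ (U m ⋆ U m)
          ≈⟨ ⋆-congˡ (U m ⋆ U m) xOneMinusX≗X⋆oneMinus1 ⟩
        (X ⋆ oneMinus 1) ⋆ (U m ⋆ U m)
          ≈⟨ ⋆-assoc X (oneMinus 1) (U m ⋆ U m) ⟩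
        X ⋆ (oneMinus 1 ⋆ (U m ⋆ U m))
          ≈⟨ ⋆-congʳ X (⋆-assoc (oneMinus 1) (U m) (U m)) ⟨
        X ⋆ ((oneMinus 1 ⋆ U m) ⋆ U m)
          ≈⟨ ⋆-congʳ X (⋆-comm (oneMinus 1 ⋆ U m) (U m)) ⟩
        X ⋆ (U m ⋆ (oneMinus 1 ⋆ U m))
          ≈⟨ ⋆-congʳ X (⋆-congʳ (U m) (toSeries-Δ (u-mono m<d))) ⟨
        X ⋆ (U m ⋆ V m) ∎
        where open ≗-Reasoning

    G₀≡u : ∀ n → G₀ d n ≡ + u d n
    G₀≡u n = begin
      H d d n                    ≡⟨ H≗oneMinus⋆U ℕₚ.≤-refl n ⟩
      (oneMinus (d ∸ d) ⋆ U d) n ≡⟨ cong (λ c → (oneMinus c ⋆ U d) n) (ℕₚ.n∸n≡0 d) ⟩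
      (oneMinus 0 ⋆ U d) n       ≡⟨ oneMinus0⋆ (U d) n ⟩
      U d n                      ∎
      where
      open ≡-Reasoning
      oneMinus0⋆ : ∀ f → oneMinus 0 ⋆ f ≗ f
      oneMinus0⋆ f zero    = ℤₚ.*-identityˡ (f 0)
      oneMinus0⋆ f (suc n) = trans (oneMinus⋆-suc 0 f n) (ℤₚ.+-identityʳ (f (suc n)))

open CountingSequence

module FiniteSums where

  open import Data.Nat as ℕ using (ℕ; zero; suc; _∸_; _≤_; _<_; z≤n; s≤s; _+_; _*_)
  import Data.Nat.Properties as ℕₚ
  open import Data.Nat.Tactic.RingSolver using (solve-∀)
  open import Data.Bool using (Bool; true; false; if_then_else_)
  open import Data.Fin using (Fin)
  import Data.Fin as Fin
  import Data.Fin.Properties as Finₚ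
  open import Function using (const; _∘_)
  import Data.Nat.ListAction as ℕᴸ
  open import Data.List using (map; tabulate)
  open import Algebra.Properties.Monoid.Sum ℕₚ.+-0-monoid using (sum; sum-syntax; sum-cong-≗; sum-replicate-zero)
  open import Relation.Binary.PropositionalEquality

  ∑-except : ∀ {n} (g h : Fin n → ℕ) a → (∀ i → i ≢ a → g i ≡ h i) → sum g + h a ≡ sum h + g a
  ∑-except g h Fin.zero    g≡h = begin
    g Fin.zero + sum (g ∘ Fin.suc) + h Fin.zero
      ≡⟨ cong (λ z → g Fin.zero + z + h Fin.zero) (sum-cong-≗ (λ i → g≡h (Fin.suc i) (λ ()))) ⟩
    g Fin.zero + sum (h ∘ Fin.suc) + h Fin.zero
      ≡⟨ swap (g Fin.zero) (sum (h ∘ Fin.suc)) (h Fin.zero) ⟩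
    h Fin.zero + sum (h ∘ Fin.suc) + g Fin.zero ∎
    where
    open ≡-Reasoning
    swap : ∀ x y z → x + y + z ≡ z + y + x
    swap = solve-∀
  ∑-except g h (Fin.suc a) g≡h = begin
    g Fin.zero + sum (g ∘ Fin.suc) + h (Fin.suc a)
      ≡⟨ ℕₚ.+-assoc (g Fin.zero) _ _ ⟩
    g Fin.zero + (sum (g ∘ Fin.suc) + h (Fin.suc a))
      ≡⟨ cong₂ _+_ (g≡h Fin.zero (λ ()))
                   (∑-except (g ∘ Fin.suc) (h ∘ Fin.suc) a (λ i i≢a → g≡h (Fin.suc i) (i≢a ∘ Finₚ.suc-injective))) ⟩
    h Fin.zero + (sum (h ∘ Fin.suc) + g (Fin.suc a))
      ≡⟨ ℕₚ.+-assoc (h Fin.zero) _ _ ⟨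
    h Fin.zero + sum (h ∘ Fin.suc) + g (Fin.suc a) ∎
    where open ≡-Reasoning

  ∑-zero : ∀ {n} (g : Fin n → ℕ) → (∀ i → g i ≡ 0) → sum g ≡ 0
  ∑-zero {n} g g≡0 = trans (sum-cong-≗ g≡0) (sum-replicate-zero n)

  ∑-single : ∀ {n} (g : Fin n → ℕ) a → (∀ i → i ≢ a → g i ≡ 0) → sum g ≡ g a
  ∑-single {n} g a g≡0 = begin
    sum g                  ≡⟨ ℕₚ.+-identityʳ (sum g) ⟨
    sum g + 0              ≡⟨ ∑-except g (const 0) a g≡0 ⟩
    sum {n} (const 0) + g a ≡⟨ cong (_+ g a) (∑-zero {n} (const 0) (λ _ → refl)) ⟩
    g a                    ∎
    where open ≡-Reasoning

  count : ∀ {n} → (Fin n → Bool) → ℕ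
  count {n} b = ∑[ i < n ] (if b i then 1 else 0)

  count-cong : ∀ {n} {b c : Fin n → Bool} → (∀ i → b i ≡ c i) → count b ≡ count c
  count-cong b≗c = sum-cong-≗ (λ i → cong (λ x → if x then 1 else 0) (b≗c i))

  count-true : ∀ n → count {n} (const true) ≡ n
  count-true zero    = refl
  count-true (suc n) = cong suc (count-true n)

  count-≤ : ∀ {n} (b : Fin n → Bool) → count b ≤ n
  count-≤ {zero}  b = z≤n
  count-≤ {suc n} b with b Fin.zero
  ... | true  = s≤s (count-≤ (b ∘ Fin.suc))
  ... | false = ℕₚ.m≤n⇒m≤1+n (count-≤ (b ∘ Fin.suc))

  count-< : ∀ {n} (b : Fin n → Bool) i → b i ≡ false → count b < n
  count-< b Fin.zero    b0≡false rewrite b0≡false = s≤s (count-≤ (b ∘ Fin.suc))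
  count-< b (Fin.suc i) bi≡false with b Fin.zero
  ... | true  = s≤s (count-< (b ∘ Fin.suc) i bi≡false)
  ... | false = ℕₚ.m≤n⇒m≤1+n (count-< (b ∘ Fin.suc) i bi≡false)

  count-suc : ∀ {n} (b c : Fin n → Bool) i → (∀ j → j ≢ i → b j ≡ c j) →
              b i ≡ false → c i ≡ true → count c ≡ suc (count b)
  count-suc b c i b≡c bi≡false ci≡true = begin
    count c                          ≡⟨ ℕₚ.+-identityʳ (count c) ⟨
    count c + 0                      ≡⟨ cong (λ x → count c + (if x then 1 else 0)) bi≡false ⟨
    count c + (if b i then 1 else 0) ≡⟨ ∑-except _ _ i (λ j j≢i → cong (λ x → if x then 1 else 0) (sym (b≡c j j≢i))) ⟩
    count b + (if c i then 1 else 0) ≡⟨ cong (λ x → count b + (if x then 1 else 0)) ci≡true ⟩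
    count b + 1                      ≡⟨ ℕₚ.+-comm (count b) 1 ⟩
    suc (count b)                    ∎
    where open ≡-Reasoning

  ∑-if : ∀ {n} (b : Fin n → Bool) A C → ∑[ i < n ] (if b i then A else C) ≡ count b * A + (n ∸ count b) * C
  ∑-if {zero}  b A C = refl
  ∑-if {suc n} b A C with b Fin.zero
  ... | true  rewrite ∑-if (b ∘ Fin.suc) A C = sym (ℕₚ.+-assoc A _ _)
  ... | false rewrite ∑-if (b ∘ Fin.suc) A C | ℕₚ.+-∸-assoc 1 (count-≤ (b ∘ Fin.suc)) =
    swap C (count (b ∘ Fin.suc) * A) ((n ∸ count (b ∘ Fin.suc)) * C)
    where
    swap : ∀ x y z → x + (y + z) ≡ y + (x + z)
    swap = solve-∀

  sum-map-tabulate : ∀ {A : Set} {n} (h : A → ℕ) (f : Fin n → A) → ℕᴸ.sum (map h (tabulate f)) ≡ sum (h ∘ f)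
  sum-map-tabulate {n = zero}  h f = refl
  sum-map-tabulate {n = suc n} h f = cong (h (f Fin.zero) ℕ.+_) (sum-map-tabulate h (f ∘ Fin.suc))

open FiniteSums

module ListProperties where

  import Data.Nat as ℕ
  import Data.Nat.ListAction as ℕᴸ
  open import Data.List using (List; []; _∷_; map; concatMap; cartesianProductWith; length; filter)
  open import Data.List.Properties using (length-++; length-map; filter-≐)
  open import Data.List.Membership.Propositional using (_∈_; find; lose)
  open import Data.List.Membership.Propositional.Properties using (∈-concatMap⁺; ∈-concatMap⁻)
  import Data.List.Relation.Unary.All as All
  open import Data.List.Relation.Unary.AllPairs using ([]; _∷_)
  open import Data.List.Relation.Unary.Unique.Propositional using (Unique)
  import Data.List.Relation.Unary.Unique.Propositional.Properties as Uniqueₚ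
  open import Data.Product using (∃; _×_; _,_; proj₁; swap)
  open import Function using (_∘_)
  open import Level using (0ℓ)
  open import Relation.Nullary using (¬_; yes; no)
  open import Relation.Unary using (Pred; Decidable; _⊆_)
  open import Relation.Unary.Properties using (_∩?_)
  open import Relation.Binary.PropositionalEquality

  length-cartesianProductWith : ∀ {A B C : Set} (f : A → B → C) xs ys →
                                length (cartesianProductWith f xs ys) ≡ length xs ℕ.* length ys
  length-cartesianProductWith f []       ys = refl
  length-cartesianProductWith f (x ∷ xs) ys = trans (length-++ (map (f x) ys))
    (cong₂ ℕ._+_ (length-map (f x) ys) (length-cartesianProductWith f xs ys))

  module _ {A B : Set} where

    length-concatMap : ∀ (g : A → List B) xs → length (concatMap g xs) ≡ ℕᴸ.sum (map (length ∘ g) xs)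
    length-concatMap g []       = refl
    length-concatMap g (x ∷ xs) = trans (length-++ (g x)) (cong (length (g x) ℕ.+_) (length-concatMap g xs))

    ∈-concatMap⁻′ : ∀ (g : A → List B) xs {z} → z ∈ concatMap g xs → ∃ λ x → x ∈ xs × z ∈ g x
    ∈-concatMap⁻′ g xs = find ∘ ∈-concatMap⁻ g

    ∈-concatMap⁺′ : ∀ (g : A → List B) {xs x z} → x ∈ xs → z ∈ g x → z ∈ concatMap g xs
    ∈-concatMap⁺′ g x∈ z∈ = ∈-concatMap⁺ g (lose x∈ z∈)

    concatMap⁺ : ∀ (g : A → List B) {xs} → Unique xs → (∀ x → Unique (g x)) →
                 (∀ {x y z} → z ∈ g x → z ∈ g y → x ≡ y) → Unique (concatMap g xs)
    concatMap⁺ g {[]}     _            _      _     = []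
    concatMap⁺ g {x ∷ xs} (x∉xs ∷ !xs) !g determ =
      Uniqueₚ.++⁺ (!g x) (concatMap⁺ g !xs !g determ) disjoint
      where
      disjoint : ∀ {z} → ¬ (z ∈ g x × z ∈ concatMap g xs)
      disjoint (z∈gx , z∈rest) with ∈-concatMap⁻′ g xs z∈rest
      ... | y , y∈xs , z∈gy = All.lookup x∉xs y∈xs (determ z∈gx z∈gy)

  filter-filter : ∀ {A : Set} {P Q : Pred A 0ℓ} (P? : Decidable P) (Q? : Decidable Q) xs →
                  filter P? (filter Q? xs) ≡ filter (P? ∩? Q?) xs
  filter-filter P? Q? []       = refl
  filter-filter P? Q? (x ∷ xs) with Q? x
  ... | yes _ with P? x
  ...   | yes _ = cong (x ∷_) (filter-filter P? Q? xs)
  ...   | no  _ = filter-filter P? Q? xs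
  filter-filter P? Q? (x ∷ xs) | no _ with P? x
  ...   | yes _ = filter-filter P? Q? xs
  ...   | no  _ = filter-filter P? Q? xs

  module _ {A : Set} {P Q : Pred A 0ℓ} where

    filter-filter-⊆ : ∀ (P? : Decidable P) (Q? : Decidable Q) → P ⊆ Q → ∀ xs → filter P? (filter Q? xs) ≡ filter P? xs
    filter-filter-⊆ P? Q? P⊆Q xs = trans (filter-filter P? Q? xs) (filter-≐ (P? ∩? Q?) P? (proj₁ , λ px → px , P⊆Q px) xs)

    filter-filter-comm : ∀ (P? : Decidable P) (Q? : Decidable Q) xs → filter P? (filter Q? xs) ≡ filter Q? (filter P? xs)
    filter-filter-comm P? Q? xs = begin
      filter P? (filter Q? xs) ≡⟨ filter-filter P? Q? xs ⟩
      filter (P? ∩? Q?) xs     ≡⟨ filter-≐ (P? ∩? Q?) (Q? ∩? P?) (swap , swap) xs ⟩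
      filter (Q? ∩? P?) xs     ≡⟨ filter-filter Q? P? xs ⟨
      filter Q? (filter P? xs) ∎
      where open ≡-Reasoning

open ListProperties

module AdmissibleTrees where

  open import Data.Nat as ℕ using (ℕ; zero; suc; _∸_; _≤_; s≤s)
  import Data.Nat.Properties as ℕₚ
  import Data.Nat.ListAction as ℕᴸ
  open import Data.Bool using (Bool; true; false; _∧_; if_then_else_; _≟_)
  open import Data.Bool.Properties using (∧-zeroʳ)
  open import Data.Fin using (Fin)
  import Data.Fin.Properties as Finₚ
  open import Data.Maybe using (Maybe; just; nothing)
  import Data.Maybe.Properties as Maybeₚ
  open import Data.List using (List; []; _∷_; map; concatMap; cartesianProductWith; length; upTo; allFin)
  open import Data.List.Properties using (map-cong)
  open import Data.List.Membership.Propositional using (_∈_)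
  open import Data.List.Membership.Propositional.Properties
    using (∈-cartesianProductWith⁺; ∈-cartesianProductWith⁻; ∈-allFin; ∈-upTo⁺; ∈-upTo⁻)
  open import Data.List.Relation.Unary.Any using (here)
  open import Data.List.Relation.Unary.All using ([])
  open import Data.List.Relation.Unary.AllPairs using ([]; _∷_)
  open import Data.List.Relation.Unary.Unique.Propositional using (Unique)
  import Data.List.Relation.Unary.Unique.Propositional.Properties as Uniqueₚ
  open import Data.Vec.Functional using (updateAt)
  open import Data.Vec.Functional.Properties using (updateAt-updates; updateAt-minimal; updateAt-id-local)
  open import Algebra.Properties.Monoid.Sum ℕₚ.+-0-monoid using (sum-syntax; sum-cong-≗)
  open import Data.Product using (∃; ∃₂; _×_; _,_; proj₁; proj₂)
  open import Data.Sum using (_⊎_; inj₁; inj₂)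
  open import Data.Unit using (⊤; tt)
  open import Data.Empty using (⊥-elim)
  open import Function using (_∘_; id; const)
  open import Relation.Nullary using (¬_; Dec; yes; no; ¬?)
  open import Relation.Nullary.Decidable using (_×-dec_; _⊎-dec_; _→-dec_)
  open import Relation.Binary.PropositionalEquality

  -- For each axis j: does the current subbox lie on the lower / upper facet of the
  -- outer box in direction j?
  record Contact (d : ℕ) : Set where
    constructor contact
    field
      atLo atHi : Fin d → Bool

  open Contact public

  module _ {d : ℕ} where

    lowerContact upperContact : Contact d → Fin d → Contact d
    lowerContact s i = contact (atLo s) (updateAt (atHi s) i (const false))
    upperContact s i = contact (updateAt (atLo s) i (const false)) (atHi s)

    Touches : Contact d → Fin d → Set
    Touches s j = atLo s j ≡ true ⊎ atHi s j ≡ true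

    touches? : ∀ s j → Dec (Touches s j)
    touches? s j = (atLo s j ≟ true) ⊎-dec (atHi s j ≟ true)

    -- `banned` is the colour of the parent cut when the subbox is its upper part: a cut of
    -- that colour would be a higher splitting hyperplane of the parent.
    Allowed : Contact d → (banned : Maybe (Fin d)) → Fin d → Set
    Allowed s banned i = banned ≢ just i × (∀ j → j ≢ i → Touches s j)

    allowed? : ∀ s banned i → Dec (Allowed s banned i)
    allowed? s banned i =
      ¬? (Maybeₚ.≡-dec Finₚ._≟_ banned (just i)) ×-dec Finₚ.all? (λ j → ¬? (j Finₚ.≟ i) →-dec touches? s j)

    Admissible : Contact d → Maybe (Fin d) → Tree d → Set
    Admissible s banned leaf         = ⊤
    Admissible s banned (node i l r) =
      Allowed s banned i × Admissible (lowerContact s i) nothing l × Admissible (upperContact s i) (just i) r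

    node-injective : ∀ {i i′ l l′ r r′} → node {d} i l r ≡ node i′ l′ r′ → i ≡ i′ × l ≡ l′ × r ≡ r′
    node-injective refl = refl , refl , refl

    -- trees k s banned n lists the admissible trees with n cuts, for fuel k ≥ n.
    trees : ℕ → Contact d → Maybe (Fin d) → ℕ → List (Tree d)
    rootedTrees : ℕ → Contact d → Maybe (Fin d) → ℕ → Fin d → List (Tree d)
    childTrees : ℕ → Contact d → Fin d → ℕ → List (Tree d)
    splitTrees : ℕ → Contact d → Fin d → ℕ → ℕ → List (Tree d)

    trees _       s banned zero    = leaf ∷ []
    trees zero    s banned (suc n) = []
    trees (suc k) s banned (suc n) = concatMap (rootedTrees k s banned n) (allFin d)

    rootedTrees k s banned n i with allowed? s banned i
    ... | yes _ = childTrees k s i n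
    ... | no  _ = []

    childTrees k s i n = concatMap (splitTrees k s i n) (upTo (suc n))

    splitTrees k s i n a =
      cartesianProductWith (node i) (trees k (lowerContact s i) nothing a) (trees k (upperContact s i) (just i) (n ∸ a))

    rootedTrees-allowed : ∀ {k s banned n i} → Allowed s banned i → rootedTrees k s banned n i ≡ childTrees k s i n
    rootedTrees-allowed {k} {s} {banned} {n} {i} al with allowed? s banned i
    ... | yes _ = refl
    ... | no ¬al = ⊥-elim (¬al al)

    length-rootedTrees-disallowed : ∀ k s banned n i → ¬ Allowed s banned i → length (rootedTrees k s banned n i) ≡ 0
    length-rootedTrees-disallowed k s banned n i ¬al with allowed? s banned i
    ... | yes al = ⊥-elim (¬al al)
    ... | no _   = refl

    ∈-rootedTrees⁻ : ∀ k s banned n i {T} → T ∈ rootedTrees k s banned n i → Allowed s banned i × T ∈ childTrees k s i n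
    ∈-rootedTrees⁻ k s banned n i T∈ with allowed? s banned i
    ... | yes al = al , T∈
    ∈-rootedTrees⁻ k s banned n i () | no _

    ∈-childTrees⁻ : ∀ k s i n {T} → T ∈ childTrees k s i n →
      ∃ λ a → a ≤ n × ∃₂ λ l r → T ≡ node i l r ×
        l ∈ trees k (lowerContact s i) nothing a × r ∈ trees k (upperContact s i) (just i) (n ∸ a)
    ∈-childTrees⁻ k s i n T∈ with ∈-concatMap⁻′ (splitTrees k s i n) (upTo (suc n)) T∈
    ... | a , a∈ , T∈a with ∈-cartesianProductWith⁻ (node i) (trees k (lowerContact s i) nothing a) _ T∈a
    ... | l , r , l∈ , r∈ , T≡ = a , ℕₚ.≤-pred (∈-upTo⁻ a∈) , l , r , T≡ , l∈ , r∈

    trees-sound : ∀ k s banned n {T} → T ∈ trees k s banned n → Admissible s banned T × size T ≡ n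
    trees-sound k       s banned zero    (here refl) = tt , refl
    trees-sound zero    s banned (suc n) ()
    trees-sound (suc k) s banned (suc n) T∈ with ∈-concatMap⁻′ (rootedTrees k s banned n) (allFin d) T∈
    ... | i , _ , T∈i with ∈-rootedTrees⁻ k s banned n i T∈i
    ... | al , T∈c with ∈-childTrees⁻ k s i n T∈c
    ... | a , a≤n , l , r , refl , l∈ , r∈ with trees-sound k _ _ a l∈ | trees-sound k _ _ (n ∸ a) r∈
    ... | adm-l , size-l | adm-r , size-r =
      (al , adm-l , adm-r) , cong suc (trans (cong₂ ℕ._+_ size-l size-r) (ℕₚ.m+[n∸m]≡n a≤n))

    trees-complete : ∀ {k s banned} T → size T ≤ k → Admissible s banned T → T ∈ trees k s banned (size T)
    trees-complete leaf _ _ = here refl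
    trees-complete {suc k} {s} {banned} (node i l r) (s≤s size≤k) (al , adm-l , adm-r) =
      ∈-concatMap⁺′ (rootedTrees k s banned (size l ℕ.+ size r)) (∈-allFin i)
        (subst (node i l r ∈_) (sym (rootedTrees-allowed al))
          (∈-concatMap⁺′ (splitTrees k s i (size l ℕ.+ size r)) (∈-upTo⁺ (s≤s (ℕₚ.m≤m+n (size l) (size r))))
            (∈-cartesianProductWith⁺ (node i) l∈ r∈)))
      where
      l∈ : l ∈ trees k (lowerContact s i) nothing (size l)
      l∈ = trees-complete l (ℕₚ.≤-trans (ℕₚ.m≤m+n (size l) (size r)) size≤k) adm-l
      r∈ : r ∈ trees k (upperContact s i) (just i) (size l ℕ.+ size r ∸ size l)
      r∈ = subst (λ m → r ∈ trees k (upperContact s i) (just i) m) (sym (ℕₚ.m+n∸m≡n (size l) (size r)))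
             (trees-complete r (ℕₚ.≤-trans (ℕₚ.m≤n+m (size r) (size l)) size≤k) adm-r)

    trees-unique : ∀ k s banned n → Unique (trees k s banned n)
    childTrees-unique : ∀ k s i n → Unique (childTrees k s i n)

    trees-unique k       s banned zero    = [] ∷ []
    trees-unique zero    s banned (suc n) = []
    trees-unique (suc k) s banned (suc n) =
      concatMap⁺ (rootedTrees k s banned n) (Uniqueₚ.allFin⁺ d) rooted-unique same-root
      where
      rooted-unique : ∀ i → Unique (rootedTrees k s banned n i)
      rooted-unique i with allowed? s banned i
      ... | yes _ = childTrees-unique k s i n
      ... | no  _ = []
      rootOf : ∀ i {T} → T ∈ rootedTrees k s banned n i → ∃₂ λ l r → T ≡ node i l r
      rootOf i T∈ with ∈-childTrees⁻ k s i n (proj₂ (∈-rootedTrees⁻ k s banned n i T∈))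
      ... | _ , _ , l , r , T≡ , _ = l , r , T≡
      same-root : ∀ {i j T} → T ∈ rootedTrees k s banned n i → T ∈ rootedTrees k s banned n j → i ≡ j
      same-root T∈i T∈j with rootOf _ T∈i | rootOf _ T∈j
      ... | _ , _ , refl | _ , _ , T≡ = proj₁ (node-injective T≡)

    childTrees-unique k s i n = concatMap⁺ (splitTrees k s i n) (Uniqueₚ.upTo⁺ (suc n)) split-unique same-split
      where
      split-unique : ∀ a → Unique (splitTrees k s i n a)
      split-unique a = Uniqueₚ.cartesianProductWith⁺ (node i) (proj₂ ∘ node-injective)
        (trees-unique k (lowerContact s i) nothing a) (trees-unique k (upperContact s i) (just i) (n ∸ a))
      leftSize : ∀ {a T} → T ∈ splitTrees k s i n a → ∃₂ λ l r → T ≡ node i l r × size l ≡ a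
      leftSize {a} T∈ with ∈-cartesianProductWith⁻ (node i) (trees k (lowerContact s i) nothing a) _ T∈
      ... | l , r , l∈ , _ , T≡ = l , r , T≡ , proj₂ (trees-sound k _ _ a l∈)
      same-split : ∀ {a b T} → T ∈ splitTrees k s i n a → T ∈ splitTrees k s i n b → a ≡ b
      same-split {a} {b} T∈a T∈b with leftSize {a} T∈a | leftSize {b} T∈b
      ... | l , _ , refl , refl | _ , _ , T≡ , refl = cong size (proj₁ (proj₂ (node-injective T≡)))

    cleared : ∀ (g : Fin d → Bool) i → updateAt g i (const false) i ≡ false
    cleared g i = updateAt-updates i g

    kept : ∀ (g : Fin d → Bool) {i j} → j ≢ i → updateAt g i (const false) j ≡ g j
    kept g {i} {j} j≢i = updateAt-minimal j i g j≢i

    lowerContact-touches : ∀ s {i j} → j ≢ i → Touches s j → Touches (lowerContact s i) j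
    lowerContact-touches s j≢i (inj₁ lo) = inj₁ lo
    lowerContact-touches s j≢i (inj₂ hi) = inj₂ (trans (kept (atHi s) j≢i) hi)

    upperContact-touches : ∀ s {i j} → j ≢ i → Touches s j → Touches (upperContact s i) j
    upperContact-touches s j≢i (inj₁ lo) = inj₁ (trans (kept (atLo s) j≢i) lo)
    upperContact-touches s j≢i (inj₂ hi) = inj₂ hi

    NoDead : Contact d → Set
    NoDead s = ∀ j → Touches s j

    noDead-lower : ∀ {s i} → NoDead s → atLo s i ≡ true → NoDead (lowerContact s i)
    noDead-lower {s} {i} noDead lo j with j Finₚ.≟ i
    ... | yes refl = inj₁ lo
    ... | no j≢i   = lowerContact-touches s j≢i (noDead j)

    noDead-upper : ∀ {s i} → NoDead s → atHi s i ≡ true → NoDead (upperContact s i)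
    noDead-upper {s} {i} noDead hi j with j Finₚ.≟ i
    ... | yes refl = inj₂ hi
    ... | no j≢i   = upperContact-touches s j≢i (noDead j)

    freeAxes : Contact d → ℕ
    freeAxes s = count (λ j → atLo s j ∧ atHi s j)

    freeAxes-lower : ∀ s i → atHi s i ≡ false → freeAxes (lowerContact s i) ≡ freeAxes s
    freeAxes-lower s i hi = count-cong (λ j → cong (atLo s j ∧_) (updateAt-id-local i (atHi s) (sym hi) j))

    freeAxes-upper : ∀ s i → atLo s i ≡ false → freeAxes (upperContact s i) ≡ freeAxes s
    freeAxes-upper s i lo = count-cong (λ j → cong (_∧ atHi s j) (updateAt-id-local i (atLo s) (sym lo) j))

    freeAxes-lower-suc : ∀ s i → atLo s i ≡ true → atHi s i ≡ true → freeAxes s ≡ suc (freeAxes (lowerContact s i))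
    freeAxes-lower-suc s i lo hi = count-suc _ _ i (λ j j≢i → cong (atLo s j ∧_) (kept (atHi s) j≢i))
      (trans (cong (atLo s i ∧_) (cleared (atHi s) i)) (∧-zeroʳ (atLo s i))) (cong₂ _∧_ lo hi)

    freeAxes-upper-suc : ∀ s i → atLo s i ≡ true → atHi s i ≡ true → freeAxes s ≡ suc (freeAxes (upperContact s i))
    freeAxes-upper-suc s i lo hi = count-suc _ _ i (λ j j≢i → cong (_∧ atHi s j) (kept (atLo s) j≢i))
      (cong (_∧ atHi s i) (cleared (atLo s) i)) (cong₂ _∧_ lo hi)

    Dead : Contact d → Fin d → Set
    Dead s a = atLo s a ≡ false × atHi s a ≡ false

    dead-untouched : ∀ {s a} → Dead s a → ¬ Touches s a
    dead-untouched (lo , _) (inj₁ lo′) with () ← trans (sym lo) lo′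
    dead-untouched (_ , hi) (inj₂ hi′) with () ← trans (sym hi) hi′

    OnlyDead : Contact d → Fin d → Set
    OnlyDead s a = Dead s a × (∀ j → j ≢ a → Touches s j)

    -- These four situations are closed under passing to the two parts of an allowed cut,
    -- which is what lets length-trees be proved by induction.
    data Regime (s : Contact d) : Maybe (Fin d) → Set where
      touching       : NoDead s → Regime s nothing
      touchingBanned : ∀ {j} → NoDead s → atLo s j ≡ false → Regime s (just j)
      oneDead        : ∀ {a} → OnlyDead s a → Regime s nothing
      oneDeadBanned  : ∀ {a} → OnlyDead s a → Regime s (just a)

    regimeCount : ∀ {s banned} → Regime s banned → ℕ → ℕ
    regimeCount {s} (touching _)         = u d (freeAxes s)
    regimeCount {s} (touchingBanned _ _) = Δ (u d (freeAxes s))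
    regimeCount     (oneDead _)          = const 1
    regimeCount     (oneDeadBanned _)    = δ

    regimeCount-zero : ∀ {s banned} (ρ : Regime s banned) → regimeCount ρ 0 ≡ 1
    regimeCount-zero {s} (touching _)         = u-zero d (freeAxes s)
    regimeCount-zero {s} (touchingBanned _ _) = u-zero d (freeAxes s)
    regimeCount-zero     (oneDead _)          = refl
    regimeCount-zero     (oneDeadBanned _)    = refl

    length-trees-suc : ∀ k s banned n → length (trees (suc k) s banned (suc n)) ≡ ∑[ i < d ] length (rootedTrees k s banned n i)
    length-trees-suc k s banned n =
      trans (length-concatMap (rootedTrees k s banned n) (allFin d)) (sum-map-tabulate (length ∘ rootedTrees k s banned n) id)

    length-childTrees : ∀ k s i n → length (childTrees k s i n) ≡
      ((length ∘ trees k (lowerContact s i) nothing) ⋆ℕ (length ∘ trees k (upperContact s i) (just i))) n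
    length-childTrees k s i n = begin
      length (childTrees k s i n)
        ≡⟨ length-concatMap (splitTrees k s i n) (upTo (suc n)) ⟩
      ℕᴸ.sum (map (length ∘ splitTrees k s i n) (upTo (suc n)))
        ≡⟨ cong ℕᴸ.sum (map-cong (λ a → length-cartesianProductWith (node i) (lower a) (upper (n ∸ a))) (upTo (suc n))) ⟩
      ℕᴸ.sum (map (λ a → length (lower a) ℕ.* length (upper (n ∸ a))) (upTo (suc n)))
        ≡⟨ sum-upTo≡⋆ℕ (length ∘ lower) (length ∘ upper) n ⟩
      ((length ∘ lower) ⋆ℕ (length ∘ upper)) n ∎
      where
      open ≡-Reasoning
      lower upper : ℕ → List (Tree d)
      lower = trees k (lowerContact s i) nothing
      upper = trees k (upperContact s i) (just i)

    CountedUpTo : ℕ → ℕ → Set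
    CountedUpTo k n = ∀ {s banned} (ρ : Regime s banned) a → a ≤ n → length (trees k s banned a) ≡ regimeCount ρ a

    length-rootedTrees-via : ∀ {k n s banned i} → CountedUpTo k n → Allowed s banned i →
      (ρ⁻ : Regime (lowerContact s i) nothing) (ρ⁺ : Regime (upperContact s i) (just i)) →
      length (rootedTrees k s banned n i) ≡ (regimeCount ρ⁻ ⋆ℕ regimeCount ρ⁺) n
    length-rootedTrees-via {k} {n} {s} {banned} {i} IH al ρ⁻ ρ⁺ = begin
      length (rootedTrees k s banned n i) ≡⟨ cong length (rootedTrees-allowed al) ⟩
      length (childTrees k s i n)    ≡⟨ length-childTrees k s i n ⟩
      _                              ≡⟨ ⋆ℕ-cong-≤ n (IH ρ⁻) (IH ρ⁺) ⟩
      (regimeCount ρ⁻ ⋆ℕ regimeCount ρ⁺) n ∎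
      where open ≡-Reasoning

    rootCount : Contact d → ℕ → Fin d → ℕ
    rootCount s n i =
      if atLo s i ∧ atHi s i then (u d (freeAxes s ∸ 1) ⋆ℕ Δ (u d (freeAxes s ∸ 1))) n else u d (freeAxes s) n

    length-rootedTrees-touching : ∀ {k n s banned i} → CountedUpTo k n → NoDead s → Allowed s banned i →
                                  length (rootedTrees k s banned n i) ≡ rootCount s n i
    length-rootedTrees-touching {k} {n} {s} {banned} {i} IH noDead al with atLo s i in lo | atHi s i in hi
    ... | true  | true  = begin
      length (rootedTrees k s banned n i)
        ≡⟨ length-rootedTrees-via IH al (touching (noDead-lower noDead lo))
             (touchingBanned (noDead-upper noDead hi) (cleared (atLo s) i)) ⟩
      (u d (freeAxes (lowerContact s i)) ⋆ℕ Δ (u d (freeAxes (upperContact s i)))) n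
        ≡⟨ cong₂ (λ p q → (u d p ⋆ℕ Δ (u d q)) n)
                 (cong (_∸ 1) (freeAxes-lower-suc s i lo hi)) (cong (_∸ 1) (freeAxes-upper-suc s i lo hi)) ⟨
      (u d (freeAxes s ∸ 1) ⋆ℕ Δ (u d (freeAxes s ∸ 1))) n ∎
      where open ≡-Reasoning
    ... | true  | false = begin
      length (rootedTrees k s banned n i)
        ≡⟨ length-rootedTrees-via IH al (touching (noDead-lower noDead lo))
             (oneDeadBanned ((cleared (atLo s) i , hi) , λ j j≢i → upperContact-touches s j≢i (noDead j))) ⟩
      (u d (freeAxes (lowerContact s i)) ⋆ℕ δ) n ≡⟨ ⋆ℕ-δ (u d (freeAxes (lowerContact s i))) n ⟩
      u d (freeAxes (lowerContact s i)) n        ≡⟨ cong (λ r → u d r n) (freeAxes-lower s i hi) ⟩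
      u d (freeAxes s) n                         ∎
      where open ≡-Reasoning
    ... | false | true  = begin
      length (rootedTrees k s banned n i)
        ≡⟨ length-rootedTrees-via IH al (oneDead ((lo , cleared (atHi s) i) , λ j j≢i → lowerContact-touches s j≢i (noDead j)))
             (touchingBanned (noDead-upper noDead hi) (cleared (atLo s) i)) ⟩
      (const 1 ⋆ℕ Δ (u d (freeAxes (upperContact s i)))) n
        ≡⟨ cong (λ r → (const 1 ⋆ℕ Δ (u d r)) n) (freeAxes-upper s i lo) ⟩
      (const 1 ⋆ℕ Δ (u d (freeAxes s))) n
        ≡⟨ const1⋆ℕΔ (u-mono d (count-< _ i (cong (_∧ atHi s i) lo))) n ⟩
      u d (freeAxes s) n ∎
      where open ≡-Reasoning
    ... | false | false = ⊥-elim (dead-untouched {s} {i} (lo , hi) (noDead i))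

    ∑-rootCount : ∀ s n → ∑[ i < d ] rootCount s n i ≡ u d (freeAxes s) (suc n)
    ∑-rootCount s n = trans (∑-if (λ i → atLo s i ∧ atHi s i) _ _) (u-suc d (freeAxes s) n)

    module _ {k n : ℕ} (IH : CountedUpTo k n) {s : Contact d} where

      ∑-rootedTrees-touching : NoDead s → ∑[ i < d ] length (rootedTrees k s nothing n i) ≡ u d (freeAxes s) (suc n)
      ∑-rootedTrees-touching noDead =
        trans (sum-cong-≗ (λ i → length-rootedTrees-touching {s = s} {nothing} {i} IH noDead ((λ ()) , λ j _ → noDead j)))
              (∑-rootCount s n)

      -- Banning the colour j removes exactly the trees rooted at j, of which there are u n.
      ∑-rootedTrees-touchingBanned : ∀ {j} → NoDead s → atLo s j ≡ false →
        ∑[ i < d ] length (rootedTrees k s (just j) n i) ≡ Δ (u d (freeAxes s)) (suc n)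
      ∑-rootedTrees-touchingBanned {j} noDead lo = begin
        ∑[ i < d ] len i                               ≡⟨ ℕₚ.m+n∸n≡m (∑[ i < d ] len i) (u d r n) ⟨
        ∑[ i < d ] len i ℕ.+ u d r n ∸ u d r n          ≡⟨ cong (λ z → ∑[ i < d ] len i ℕ.+ z ∸ u d r n) rootCount-j ⟨
        ∑[ i < d ] len i ℕ.+ rootCount s n j ∸ u d r n  ≡⟨ cong (_∸ u d r n) (∑-except len (rootCount s n) j same-off-j) ⟩
        ∑[ i < d ] rootCount s n i ℕ.+ len j ∸ u d r n  ≡⟨ cong₂ (λ x y → x ℕ.+ y ∸ u d r n) (∑-rootCount s n) len-j ⟩
        u d r (suc n) ℕ.+ 0 ∸ u d r n                   ≡⟨ cong (_∸ u d r n) (ℕₚ.+-identityʳ _) ⟩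
        u d r (suc n) ∸ u d r n                         ∎
        where
        open ≡-Reasoning
        r : ℕ
        r = freeAxes s
        len : Fin d → ℕ
        len i = length (rootedTrees k s (just j) n i)
        same-off-j : ∀ i → i ≢ j → len i ≡ rootCount s n i
        same-off-j i i≢j = length-rootedTrees-touching {s = s} {just j} {i} IH noDead
          ((λ e → i≢j (sym (Maybeₚ.just-injective e))) , λ j′ _ → noDead j′)
        rootCount-j : rootCount s n j ≡ u d r n
        rootCount-j = cong (λ b → if b ∧ atHi s j then (u d (r ∸ 1) ⋆ℕ Δ (u d (r ∸ 1))) n else u d r n) lo
        len-j : len j ≡ 0
        len-j = length-rootedTrees-disallowed k s (just j) n j (λ al → proj₁ al refl)

      ∑-rootedTrees-oneDead : ∀ {a} → OnlyDead s a → ∑[ i < d ] length (rootedTrees k s nothing n i) ≡ 1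
      ∑-rootedTrees-oneDead {a} (dead@(lo , hi) , others) = begin
        ∑[ i < d ] length (rootedTrees k s nothing n i)
          ≡⟨ ∑-single _ a (λ i i≢a → length-rootedTrees-disallowed k s nothing n i
                                       (λ al → dead-untouched {s} {a} dead (proj₂ al a (i≢a ∘ sym)))) ⟩
        length (rootedTrees k s nothing n a)
          ≡⟨ length-rootedTrees-via {s = s} {nothing} {a} IH ((λ ()) , others)
               (oneDead ((lo , cleared (atHi s) a) , λ j j≢a → lowerContact-touches s j≢a (others j j≢a)))
               (oneDeadBanned ((cleared (atLo s) a , hi) , λ j j≢a → upperContact-touches s j≢a (others j j≢a))) ⟩
        (const 1 ⋆ℕ δ) n
          ≡⟨ ⋆ℕ-δ (const 1) n ⟩
        1 ∎
        where open ≡-Reasoning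

      ∑-rootedTrees-oneDeadBanned : ∀ {a} → OnlyDead s a → ∑[ i < d ] length (rootedTrees k s (just a) n i) ≡ 0
      ∑-rootedTrees-oneDeadBanned {a} (dead , _) =
        ∑-zero _ (λ i → length-rootedTrees-disallowed k s (just a) n i (banned-or-dead i))
        where
        banned-or-dead : ∀ i → ¬ Allowed s (just a) i
        banned-or-dead i (a≢i , touch) with i Finₚ.≟ a
        ... | yes refl = a≢i refl
        ... | no i≢a   = dead-untouched {s} {a} dead (touch a (i≢a ∘ sym))

    length-trees : ∀ {k n} → n ≤ k → ∀ {s banned} (ρ : Regime s banned) → length (trees k s banned n) ≡ regimeCount ρ n
    length-trees {n = zero} _ ρ = sym (regimeCount-zero ρ)
    length-trees {suc k} {suc n} (s≤s n≤k) {s} {banned} ρ = trans (length-trees-suc k s banned n) (byRegime ρ)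
      where
      IH : CountedUpTo k n
      IH ρ′ a a≤n = length-trees (ℕₚ.≤-trans a≤n n≤k) ρ′
      byRegime : ∀ {banned} (ρ : Regime s banned) → ∑[ i < d ] length (rootedTrees k s banned n i) ≡ regimeCount ρ (suc n)
      byRegime (touching noDead)          = ∑-rootedTrees-touching IH noDead
      byRegime (touchingBanned noDead lo) = ∑-rootedTrees-touchingBanned IH noDead lo
      byRegime (oneDead only)             = ∑-rootedTrees-oneDead IH only
      byRegime (oneDeadBanned only)       = ∑-rootedTrees-oneDeadBanned IH only

    initialContact : Contact d
    initialContact = contact (const true) (const true)

    length-initialTrees : ∀ n → length (trees n initialContact nothing n) ≡ u d d n
    length-initialTrees n =
      trans (length-trees ℕₚ.≤-refl (touching {initialContact} (λ _ → inj₁ refl))) (cong (λ r → u d r n) (count-true d))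

open AdmissibleTrees

module Boxes where

  open import Data.Nat as ℕ using (ℕ)
  open import Data.Integer as ℤ using (+_)
  import Data.Integer.Properties as ℤₚ
  open import Data.Rational as ℚ using (ℚ; mkℚ; _≤_; _<_)
  import Data.Rational.Properties as ℚₚ
  import Data.Nat.Coprimality as Coprimality
  open import Data.Fin using (Fin)
  import Data.Fin.Properties as Finₚ
  open import Data.Vec using (_[_]≔_)
  import Data.Vec.Properties as Vecₚ
  open import Data.Product using (_,_; proj₁; proj₂)
  open import Relation.Nullary using (¬_; yes; no)
  open import Relation.Binary.PropositionalEquality

  <⇒≱ : ∀ {p q} → p < q → ¬ (q ≤ p)
  <⇒≱ p<q q≤p = ℚₚ.<-irrefl refl (ℚₚ.<-≤-trans p<q q≤p)

  fromℕ : ℕ → ℚ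
  fromℕ k = mkℚ (+ k) 0 (Coprimality.sym (Coprimality.1-coprimeTo k))

  fromℕ-mono-≤ : ∀ {m n} → m ℕ.≤ n → fromℕ m ≤ fromℕ n
  fromℕ-mono-≤ {m} {n} m≤n =
    ℚ.*≤* (subst₂ ℤ._≤_ (sym (ℤₚ.*-identityʳ (+ m))) (sym (ℤₚ.*-identityʳ (+ n))) (ℤ.+≤+ m≤n))

  fromℕ-mono-< : ∀ {m n} → m ℕ.< n → fromℕ m < fromℕ n
  fromℕ-mono-< {m} {n} m<n =
    ℚ.*<* (subst₂ ℤ._<_ (sym (ℤₚ.*-identityʳ (+ m))) (sym (ℤₚ.*-identityʳ (+ n))) (ℤ.+<+ m<n))

  module _ {d : ℕ} (B : Box d) (i : Fin d) (c : ℚ) where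

    lo-lowerPart : ∀ j → lo (lowerPart B i c) j ≡ lo B j
    lo-lowerPart j with j Finₚ.≟ i
    ... | yes refl = cong proj₁ (Vecₚ.lookup∘update i B (lo B i , c))
    ... | no j≢i   = cong proj₁ (Vecₚ.lookup∘update′ j≢i B (lo B i , c))

    hi-lowerPart : hi (lowerPart B i c) i ≡ c
    hi-lowerPart = cong proj₂ (Vecₚ.lookup∘update i B (lo B i , c))

    hi-lowerPart-≢ : ∀ {j} → j ≢ i → hi (lowerPart B i c) j ≡ hi B j
    hi-lowerPart-≢ j≢i = cong proj₂ (Vecₚ.lookup∘update′ j≢i B (lo B i , c))

    lo-upperPart : lo (upperPart B i c) i ≡ c
    lo-upperPart = cong proj₁ (Vecₚ.lookup∘update i B (c , hi B i))

    lo-upperPart-≢ : ∀ {j} → j ≢ i → lo (upperPart B i c) j ≡ lo B j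
    lo-upperPart-≢ j≢i = cong proj₁ (Vecₚ.lookup∘update′ j≢i B (c , hi B i))

    hi-upperPart : ∀ j → hi (upperPart B i c) j ≡ hi B j
    hi-upperPart j with j Finₚ.≟ i
    ... | yes refl = cong proj₂ (Vecₚ.lookup∘update i B (c , hi B i))
    ... | no j≢i   = cong proj₂ (Vecₚ.lookup∘update′ j≢i B (c , hi B i))

    hi-lowerPart-≤ : c ≤ hi B i → ∀ j → hi (lowerPart B i c) j ≤ hi B j
    hi-lowerPart-≤ c≤hi j with j Finₚ.≟ i
    ... | yes refl = subst (_≤ hi B i) (sym hi-lowerPart) c≤hi
    ... | no j≢i   = ℚₚ.≤-reflexive (hi-lowerPart-≢ j≢i)

    lo-upperPart-≥ : lo B i ≤ c → ∀ j → lo B j ≤ lo (upperPart B i c) j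
    lo-upperPart-≥ lo≤c j with j Finₚ.≟ i
    ... | yes refl = subst (lo B i ≤_) (sym lo-upperPart) lo≤c
    ... | no j≢i   = ℚₚ.≤-reflexive (sym (lo-upperPart-≢ j≢i))

  module _ {d : ℕ} (B : Box d) (i : Fin d) (c c′ : ℚ) where

    lowerPart-lowerPart : lowerPart (lowerPart B i c′) i c ≡ lowerPart B i c
    lowerPart-lowerPart =
      trans (cong (λ x → lowerPart B i c′ [ i ]≔ (x , c)) (lo-lowerPart B i c′ i)) (Vecₚ.[]≔-idempotent B i)

    upperPart-upperPart : upperPart (upperPart B i c) i c′ ≡ upperPart B i c′
    upperPart-upperPart =
      trans (cong (λ x → upperPart B i c [ i ]≔ (c′ , x)) (hi-upperPart B i c i)) (Vecₚ.[]≔-idempotent B i)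

    lowerPart-upperPart : lowerPart (upperPart B i c) i c′ ≡ upperPart (lowerPart B i c′) i c
    lowerPart-upperPart = begin
      upperPart B i c [ i ]≔ (lo (upperPart B i c) i , c′) ≡⟨ cong (λ x → upperPart B i c [ i ]≔ (x , c′)) (lo-upperPart B i c) ⟩
      upperPart B i c [ i ]≔ (c , c′)                      ≡⟨ Vecₚ.[]≔-idempotent B i ⟩
      B [ i ]≔ (c , c′)                                    ≡⟨ Vecₚ.[]≔-idempotent B i ⟨
      lowerPart B i c′ [ i ]≔ (c , c′)                     ≡⟨ cong (λ x → lowerPart B i c′ [ i ]≔ (c , x)) (hi-lowerPart B i c′) ⟨
      lowerPart B i c′ [ i ]≔ (c , hi (lowerPart B i c′) i) ∎
      where open ≡-Reasoning

open Boxes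

module Realization where

  open import Data.Nat as ℕ using (ℕ; suc; z≤n; s≤s)
  import Data.Nat.Properties as ℕₚ
  open import Data.Rational using (ℚ; _≤_; _<_)
  import Data.Rational.Properties as ℚₚ
  open import Data.Fin using (Fin)
  open import Data.Maybe using (Maybe; just; nothing)
  open import Data.Unit using (⊤; tt)
  open import Data.Bool using (true; false)
  open import Data.Vec.Functional using (updateAt)
  import Data.Fin.Properties as Finₚ
  open import Data.Vec using (replicate)
  import Data.Vec.Properties as Vecₚ
  open import Data.List using (List; []; _∷_; _++_)
  open import Data.List.Properties using (filter-++; filter-all; filter-none; ++-identityʳ)
  open import Data.List.Relation.Unary.All as All using (All; []; _∷_)
  import Data.List.Relation.Unary.All.Properties as Allₚ
  open import Data.Product using (Σ; ∃₂; _×_; _,_; proj₁; proj₂)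
  open import Data.Sum using (_⊎_; inj₁; inj₂)
  open import Data.Empty using (⊥-elim)
  open import Data.List.Membership.Propositional using (_∈_)
  open import Function using (_∘_; const)
  open import Function.Bundles using (_⇔_; mk⇔)
  open import Relation.Nullary using (¬_; Dec; yes; no; ¬?)
  open import Relation.Unary using (Decidable)
  open import Relation.Binary.PropositionalEquality
  open import Relation.Binary.Definitions using (tri<; tri≈; tri>)

  module _ {d : ℕ} where

    TreeOf⇒IsGuillotine : ∀ {B : Box d} {S T} → TreeOf B S T → IsGuillotine B S
    TreeOf⇒IsGuillotine (leafT S≡) = trivial S≡
    TreeOf⇒IsGuillotine (nodeT i c (lo<c , c<hi , oneSide , g⁻ , g⁺) _ _ _) = split i c lo<c c<hi oneSide g⁻ g⁺

    Highest : Box d → List (Box d) → Fin d → ℚ → Set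
    Highest B S i c = ∀ j c′ → Splitting B S j c′ → (j ≡ i) × (c′ ≤ c)

    splitting-upperPart : ∀ {B : Box d} {S i c c′} → Splitting B S i c →
                          Splitting (upperPart B i c) (above i c S) i c′ → Splitting B S i c′
    splitting-upperPart {B} {S} {i} {c} {c′} (lo<c , _ , oneSide , g⁻ , _) (c<c′ᵘ , c′<hiᵘ , oneSideᵘ , h⁻ , h⁺) =
      ℚₚ.<-trans lo<c c<c′ , c′<hi , oneSide′ , lower , upper
      where
      c<c′ : c < c′
      c<c′ = subst (_< c′) (lo-upperPart B i c) c<c′ᵘ
      c′<hi : c′ < hi B i
      c′<hi = subst (c′ <_) (hi-upperPart B i c i) c′<hiᵘ
      c≤lo? : Decidable (λ (b : Box d) → c ≤ lo b i)
      c≤lo? b = c ℚₚ.≤? lo b i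
      below-c : ∀ {b} → ((hi b i ≤ c) ⊎ (c ≤ lo b i)) × ¬ (c ≤ lo b i) → (hi b i ≤ c′) ⊎ (c′ ≤ lo b i)
      below-c (inj₁ hi≤c , _)      = inj₁ (ℚₚ.≤-trans hi≤c (ℚₚ.<⇒≤ c<c′))
      below-c (inj₂ c≤lo , ¬c≤lo) = ⊥-elim (¬c≤lo c≤lo)
      oneSide′ : OneSide i c′ S
      oneSide′ = Allₚ.filter⁻ c≤lo? oneSideᵘ
        (All.map (λ {b} → below-c {b}) (All.zip (Allₚ.filter⁺ (¬? ∘ c≤lo?) oneSide , Allₚ.all-filter (¬? ∘ c≤lo?) S)))
      -- Below c′, split first at c: the two sides are guillotined by g⁻ and h⁻.
      lower : IsGuillotine (lowerPart B i c′) (below i c′ S)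
      lower = split i c (subst (_< c) (sym (lo-lowerPart B i c′ i)) lo<c) (subst (c <_) (sym (hi-lowerPart B i c′)) c<c′)
        (Allₚ.filter⁺ (λ b → hi b i ℚₚ.≤? c′) oneSide)
        (subst₂ IsGuillotine (sym (lowerPart-lowerPart B i c c′))
          (sym (filter-filter-⊆ (λ b → hi b i ℚₚ.≤? c) (λ b → hi b i ℚₚ.≤? c′)
                                (λ hi≤c → ℚₚ.≤-trans hi≤c (ℚₚ.<⇒≤ c<c′)) S)) g⁻)
        (subst₂ IsGuillotine (lowerPart-upperPart B i c c′) (filter-filter-comm (λ b → hi b i ℚₚ.≤? c′) c≤lo? S) h⁻)
      upper : IsGuillotine (upperPart B i c′) (above i c′ S)
      upper = subst₂ IsGuillotine (upperPart-upperPart B i c c′)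
        (filter-filter-⊆ (λ b → c′ ℚₚ.≤? lo b i) c≤lo? (ℚₚ.≤-trans (ℚₚ.<⇒≤ c<c′)) S) h⁺

    RootNotBanned : Maybe (Fin d) → Tree d → Set
    RootNotBanned banned leaf         = ⊤
    RootNotBanned banned (node i _ _) = banned ≢ just i

    rootNotBanned-nothing : ∀ T → RootNotBanned nothing T
    rootNotBanned-nothing leaf         = tt
    rootNotBanned-nothing (node _ _ _) = λ ()

    upperRoot-notBanned : ∀ {B : Box d} {S i c r} → Splitting B S i c → Highest B S i c →
                          TreeOf (upperPart B i c) (above i c S) r → RootNotBanned (just i) r
    upperRoot-notBanned spl highest (leafT _) = tt
    upperRoot-notBanned {B} {i = i} {c} spl highest (nodeT _ c′ spl′ _ _ _) refl =
      <⇒≱ c<c′ (proj₂ (highest i c′ (splitting-upperPart spl spl′)))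
      where
      c<c′ : c < c′
      c<c′ = subst (_< c′) (lo-upperPart B i c) (proj₁ spl′)

    module _ (B₀ : Box d) where

      Within : Contact d → Box d → Set
      Within s B = ∀ j → (lo B₀ j ≤ lo B j) × (hi B j ≤ hi B₀ j) ×
                         (atLo s j ≡ false → lo B₀ j < lo B j) × (atHi s j ≡ false → hi B j < hi B₀ j)

      touches-within : ∀ {s B j} → Within s B → (lo B j ≡ lo B₀ j) ⊎ (hi B j ≡ hi B₀ j) → Touches s j
      touches-within {s} {B} {j} w onFacet with atLo s j in lo-flag | atHi s j in hi-flag
      ... | true  | _     = inj₁ refl
      ... | false | true  = inj₂ refl
      ... | false | false with onFacet
      ...   | inj₁ lo≡ = ⊥-elim (ℚₚ.<-irrefl (sym lo≡) (proj₁ (proj₂ (proj₂ (w j))) lo-flag))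
      ...   | inj₂ hi≡ = ⊥-elim (ℚₚ.<-irrefl hi≡ (proj₂ (proj₂ (proj₂ (w j))) hi-flag))

      within-lowerPart : ∀ {s B i c} → Within s B → c < hi B i → Within (lowerContact s i) (lowerPart B i c)
      within-lowerPart {s} {B} {i} {c} w c<hi j =
        subst (lo B₀ j ≤_) (sym (lo-lowerPart B i c j)) (proj₁ (w j)) ,
        ℚₚ.≤-trans (hi-lowerPart-≤ B i c (ℚₚ.<⇒≤ c<hi) j) (proj₁ (proj₂ (w j))) ,
        (λ lo-flag → subst (lo B₀ j <_) (sym (lo-lowerPart B i c j)) (proj₁ (proj₂ (proj₂ (w j))) lo-flag)) ,
        off-hi (j Finₚ.≟ i)
        where
        off-hi : Dec (j ≡ i) → updateAt (atHi s) i (const false) j ≡ false → hi (lowerPart B i c) j < hi B₀ j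
        off-hi (yes refl) _      = subst (_< hi B₀ i) (sym (hi-lowerPart B i c)) (ℚₚ.<-≤-trans c<hi (proj₁ (proj₂ (w i))))
        off-hi (no j≢i) hi-flag  = subst (_< hi B₀ j) (sym (hi-lowerPart-≢ B i c j≢i))
                                     (proj₂ (proj₂ (proj₂ (w j))) (trans (sym (kept (atHi s) j≢i)) hi-flag))

      within-upperPart : ∀ {s B i c} → Within s B → lo B i < c → Within (upperContact s i) (upperPart B i c)
      within-upperPart {s} {B} {i} {c} w lo<c j =
        ℚₚ.≤-trans (proj₁ (w j)) (lo-upperPart-≥ B i c (ℚₚ.<⇒≤ lo<c) j) ,
        subst (_≤ hi B₀ j) (sym (hi-upperPart B i c j)) (proj₁ (proj₂ (w j))) ,
        off-lo (j Finₚ.≟ i) ,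
        (λ hi-flag → subst (_< hi B₀ j) (sym (hi-upperPart B i c j)) (proj₂ (proj₂ (proj₂ (w j))) hi-flag))
        where
        off-lo : Dec (j ≡ i) → updateAt (atLo s) i (const false) j ≡ false → lo B₀ j < lo (upperPart B i c) j
        off-lo (yes refl) _      = subst (lo B₀ i <_) (sym (lo-upperPart B i c)) (ℚₚ.≤-<-trans (proj₁ (w i)) lo<c)
        off-lo (no j≢i) lo-flag  = subst (lo B₀ j <_) (sym (lo-upperPart-≢ B i c j≢i))
                                     (proj₁ (proj₂ (proj₂ (w j))) (trans (sym (kept (atLo s) j≢i)) lo-flag))

      treeOf⇒admissible : ∀ {B S T s banned} (p : TreeOf B S T) → BoundaryCuts B₀ p → Within s B →
                          RootNotBanned banned T → Admissible s banned T
      treeOf⇒admissible (leafT _) _ _ _ = tt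
      treeOf⇒admissible {B} {s = s} (nodeT i c spl@(lo<c , c<hi , _) highest p⁻ p⁺) (boundary , bc⁻ , bc⁺) w notBanned =
        (notBanned , λ j j≢i → touches-within {s} {B} w (boundary j j≢i)) ,
        treeOf⇒admissible p⁻ bc⁻ (within-lowerPart {s} {B} w c<hi) (rootNotBanned-nothing _) ,
        treeOf⇒admissible p⁺ bc⁺ (within-upperPart {s} {B} w lo<c) (upperRoot-notBanned spl highest p⁺)

  module _ {d : ℕ} where

    -- The subtree placed at offset off cuts at the integer positions off + 1, …, off + size T,
    -- its root at off + size l + 1.
    cutPosition : ℕ → Tree d → ℕ
    cutPosition off l = suc (off ℕ.+ size l)

    partition : Tree d → ℕ → Box d → List (Box d)
    partition leaf         off B = B ∷ []
    partition (node i l r) off B =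
      partition l off (lowerPart B i (fromℕ (cutPosition off l))) ++
      partition r (cutPosition off l) (upperPart B i (fromℕ (cutPosition off l)))

    Spans : Box d → ℕ → Tree d → Set
    Spans B off T = ∀ j → lo B j ≤ fromℕ off × fromℕ (suc (off ℕ.+ size T)) ≤ hi B j

    Subbox : Box d → Box d → Set
    Subbox b B = ∀ j → lo B j ≤ lo b j × hi b j ≤ hi B j × lo b j < hi b j

    cutPosition+size : ∀ off i l r → cutPosition off l ℕ.+ size r ≡ off ℕ.+ size (node {d} i l r)
    cutPosition+size off i l r = trans (cong suc (ℕₚ.+-assoc off (size l) (size r))) (sym (ℕₚ.+-suc off _))

    off<cutPosition : ∀ off l → off ℕ.< cutPosition off l
    off<cutPosition off l = s≤s (ℕₚ.m≤m+n off (size l))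

    cutPosition≤end : ∀ off i l r → cutPosition off l ℕ.≤ off ℕ.+ size (node {d} i l r)
    cutPosition≤end off i l r = subst (cutPosition off l ℕ.≤_) (cutPosition+size off i l r) (ℕₚ.m≤m+n _ (size r))

    module AtNode (B : Box d) (off : ℕ) (i : Fin d) (l r : Tree d) (spans : Spans B off (node i l r)) where

      k : ℕ
      k = cutPosition off l
      c : ℚ
      c = fromℕ k
      B⁻ B⁺ : Box d
      B⁻ = lowerPart B i c
      B⁺ = upperPart B i c

      lo<c : lo B i < c
      lo<c = ℚₚ.≤-<-trans (proj₁ (spans i)) (fromℕ-mono-< (off<cutPosition off l))

      c<hi : c < hi B i
      c<hi = ℚₚ.<-≤-trans (fromℕ-mono-< (s≤s (cutPosition≤end off i l r))) (proj₂ (spans i))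

      spans⁻ : Spans B⁻ off l
      spans⁻ j = subst (_≤ fromℕ off) (sym (lo-lowerPart B i c j)) (proj₁ (spans j)) , hi⁻ (j Finₚ.≟ i)
        where
        hi⁻ : Dec (j ≡ i) → fromℕ (suc (off ℕ.+ size l)) ≤ hi B⁻ j
        hi⁻ (yes refl) = ℚₚ.≤-reflexive (sym (hi-lowerPart B i c))
        hi⁻ (no j≢i)   = subst (_ ≤_) (sym (hi-lowerPart-≢ B i c j≢i))
          (ℚₚ.≤-trans (fromℕ-mono-≤ (s≤s (ℕₚ.<⇒≤ (cutPosition≤end off i l r)))) (proj₂ (spans j)))

      spans⁺ : Spans B⁺ k r
      spans⁺ j = lo⁺ (j Finₚ.≟ i) ,
        subst₂ _≤_ (cong (fromℕ ∘ suc) (sym (cutPosition+size off i l r))) (sym (hi-upperPart B i c j)) (proj₂ (spans j))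
        where
        lo⁺ : Dec (j ≡ i) → lo B⁺ j ≤ c
        lo⁺ (yes refl) = ℚₚ.≤-reflexive (lo-upperPart B i c)
        lo⁺ (no j≢i)   = subst (_≤ c) (sym (lo-upperPart-≢ B i c j≢i))
          (ℚₚ.≤-trans (proj₁ (spans j)) (fromℕ-mono-≤ (ℕₚ.<⇒≤ (off<cutPosition off l))))

      subbox⁻ : ∀ {b} → Subbox b B⁻ → Subbox b B
      subbox⁻ {b} sub j = subst (_≤ lo b j) (lo-lowerPart B i c j) (proj₁ (sub j)) ,
        ℚₚ.≤-trans (proj₁ (proj₂ (sub j))) (hi-lowerPart-≤ B i c (ℚₚ.<⇒≤ c<hi) j) , proj₂ (proj₂ (sub j))

      subbox⁺ : ∀ {b} → Subbox b B⁺ → Subbox b B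
      subbox⁺ {b} sub j = ℚₚ.≤-trans (lo-upperPart-≥ B i c (ℚₚ.<⇒≤ lo<c) j) (proj₁ (sub j)) ,
        subst (hi b j ≤_) (hi-upperPart B i c j) (proj₁ (proj₂ (sub j))) , proj₂ (proj₂ (sub j))

    partition-subbox : ∀ T off {B} → Spans B off T → All (λ b → Subbox b B) (partition T off B)
    partition-subbox leaf off spans = (λ j → ℚₚ.≤-refl , ℚₚ.≤-refl ,
      ℚₚ.≤-<-trans (proj₁ (spans j)) (ℚₚ.<-≤-trans (fromℕ-mono-< (s≤s (ℕₚ.m≤m+n off 0))) (proj₂ (spans j)))) ∷ []
    partition-subbox (node i l r) off {B} spans =
      Allₚ.++⁺ (All.map (λ {b} → subbox⁻ {b}) (partition-subbox l off spans⁻))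
               (All.map (λ {b} → subbox⁺ {b}) (partition-subbox r k spans⁺))
      where open AtNode B off i l r spans

    cutRange : ∀ T off {B} j c′ → OneSide j c′ (partition T off B) → lo B j < c′ → c′ < hi B j →
               fromℕ off < c′ × c′ ≤ fromℕ (off ℕ.+ size T)
    cutRange leaf off j c′ (inj₁ hi≤c′ ∷ []) _ c′<hi = ⊥-elim (<⇒≱ c′<hi hi≤c′)
    cutRange leaf off j c′ (inj₂ c′≤lo ∷ []) lo<c′ _ = ⊥-elim (<⇒≱ lo<c′ c′≤lo)
    cutRange (node i l r) off {B} j c′ oneSide lo<c′ c′<hi = byAxis (j Finₚ.≟ i)
      where
      k : ℕ
      k = cutPosition off l
      c : ℚ
      c = fromℕ k
      oneSide⁻ : OneSide j c′ (partition l off (lowerPart B i c))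
      oneSide⁻ = Allₚ.++⁻ˡ (partition l off (lowerPart B i c)) oneSide
      oneSide⁺ : OneSide j c′ (partition r k (upperPart B i c))
      oneSide⁺ = Allₚ.++⁻ʳ (partition l off (lowerPart B i c)) oneSide
      endˡ≤end : fromℕ (off ℕ.+ size l) ≤ fromℕ (off ℕ.+ size (node i l r))
      endˡ≤end = fromℕ-mono-≤ (ℕₚ.<⇒≤ (cutPosition≤end off i l r))
      byAxis : Dec (j ≡ i) → fromℕ off < c′ × c′ ≤ fromℕ (off ℕ.+ size (node i l r))
      byAxis (no j≢i) =
        let off<c′ , c′≤endˡ = cutRange l off j c′ oneSide⁻ (subst (_< c′) (sym (lo-lowerPart B i c j)) lo<c′)
                                                             (subst (c′ <_) (sym (hi-lowerPart-≢ B i c j≢i)) c′<hi)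
        in off<c′ , ℚₚ.≤-trans c′≤endˡ endˡ≤end
      byAxis (yes refl) with ℚₚ.<-cmp c′ c
      ... | tri< c′<c _ _ =
        let off<c′ , c′≤endˡ = cutRange l off j c′ oneSide⁻ (subst (_< c′) (sym (lo-lowerPart B i c j)) lo<c′)
                                                             (subst (c′ <_) (sym (hi-lowerPart B i c)) c′<c)
        in off<c′ , ℚₚ.≤-trans c′≤endˡ endˡ≤end
      ... | tri≈ _ refl _ = fromℕ-mono-< (off<cutPosition off l) , fromℕ-mono-≤ (cutPosition≤end off i l r)
      ... | tri> _ _ c<c′ =
        let k<c′ , c′≤end = cutRange r k j c′ oneSide⁺ (subst (_< c′) (sym (lo-upperPart B i c)) c<c′)
                                                        (subst (c′ <_) (sym (hi-upperPart B i c j)) c′<hi)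
        in ℚₚ.<-trans (fromℕ-mono-< (off<cutPosition off l)) k<c′ ,
           subst (λ z → c′ ≤ fromℕ z) (cutPosition+size off i l r) c′≤end

    -- A transverse hyperplane would lie within the cut range of the left subtree and beyond the root cut.
    splitAxis : ∀ T off {B} j c′ → OneSide j c′ (partition T off B) → lo B j < c′ → c′ < hi B j →
                ∃₂ λ l r → T ≡ node j l r
    splitAxis leaf off j c′ oneSide lo<c′ c′<hi =
      let off<c′ , c′≤off = cutRange leaf off j c′ oneSide lo<c′ c′<hi
      in ⊥-elim (<⇒≱ off<c′ (subst (λ z → c′ ≤ fromℕ z) (ℕₚ.+-identityʳ off) c′≤off))
    splitAxis (node i l r) off {B} j c′ oneSide lo<c′ c′<hi with j Finₚ.≟ i
    ... | yes refl = l , r , refl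
    ... | no j≢i   = ⊥-elim (<⇒≱ (ℚₚ.<-trans (fromℕ-mono-< (ℕₚ.n<1+n (off ℕ.+ size l))) k<c′) c′≤endˡ)
      where
      c : ℚ
      c = fromℕ (cutPosition off l)
      c′≤endˡ : c′ ≤ fromℕ (off ℕ.+ size l)
      c′≤endˡ = proj₂ (cutRange l off j c′ (Allₚ.++⁻ˡ (partition l off (lowerPart B i c)) oneSide)
                  (subst (_< c′) (sym (lo-lowerPart B i c j)) lo<c′) (subst (c′ <_) (sym (hi-lowerPart-≢ B i c j≢i)) c′<hi))
      k<c′ : fromℕ (cutPosition off l) < c′
      k<c′ = proj₁ (cutRange r (cutPosition off l) j c′ (Allₚ.++⁻ʳ (partition l off (lowerPart B i c)) oneSide)
                  (subst (_< c′) (sym (lo-upperPart-≢ B i c j≢i)) lo<c′) (subst (c′ <_) (sym (hi-upperPart B i c j)) c′<hi))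

    -- A higher parallel hyperplane would split the upper part, whose root is not of the same colour.
    highest : ∀ {B off i l r s banned} → Spans B off (node i l r) → Admissible s banned (node i l r) →
              Highest B (partition (node i l r) off B) i (fromℕ (cutPosition off l))
    highest {B} {off} {i} {l} {r} spans (_ , _ , adm⁺) j c′ (lo<c′ , c′<hi , oneSide , _)
      with splitAxis (node i l r) off j c′ oneSide lo<c′ c′<hi
    ... | _ , _ , refl = refl , ℚₚ.≮⇒≥ above-cut
      where
      open AtNode B off i l r spans
      above-cut : ¬ (c < c′)
      above-cut c<c′ with splitAxis r k i c′ (Allₚ.++⁻ʳ (partition l off B⁻) oneSide)
                            (subst (_< c′) (sym (lo-upperPart B i c)) c<c′) (subst (c′ <_) (sym (hi-upperPart B i c i)) c′<hi)
      ... | _ , _ , refl = proj₁ (proj₁ adm⁺) refl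

    module PartitionAtNode (B : Box d) (off : ℕ) (i : Fin d) (l r : Tree d) (spans : Spans B off (node i l r)) where

      open AtNode B off i l r spans public

      S⁻ S⁺ : List (Box d)
      S⁻ = partition l off B⁻
      S⁺ = partition r k B⁺

      lowerBoxes : All (λ b → hi b i ≤ c × lo b i < hi b i) S⁻
      lowerBoxes = All.map (λ {b} sub → subst (hi b i ≤_) (hi-lowerPart B i c) (proj₁ (proj₂ (sub i))) , proj₂ (proj₂ (sub i)))
                           (partition-subbox l off spans⁻)

      upperBoxes : All (λ b → c ≤ lo b i × lo b i < hi b i) S⁺
      upperBoxes = All.map (λ {b} sub → subst (_≤ lo b i) (lo-upperPart B i c) (proj₁ (sub i)) , proj₂ (proj₂ (sub i)))
                           (partition-subbox r k spans⁺)

      below-partition : below i c (S⁻ ++ S⁺) ≡ S⁻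
      below-partition = begin
        below i c (S⁻ ++ S⁺)         ≡⟨ filter-++ (λ b → hi b i ℚₚ.≤? c) S⁻ S⁺ ⟩
        below i c S⁻ ++ below i c S⁺ ≡⟨ cong₂ _++_ (filter-all _ (All.map proj₁ lowerBoxes)) (filter-none _ (All.map (λ {b} → above-c {b}) upperBoxes)) ⟩
        S⁻ ++ []                     ≡⟨ ++-identityʳ S⁻ ⟩
        S⁻                           ∎
        where
        open ≡-Reasoning
        above-c : ∀ {b} → c ≤ lo b i × lo b i < hi b i → ¬ (hi b i ≤ c)
        above-c (c≤lo , lo<hi) = <⇒≱ (ℚₚ.≤-<-trans c≤lo lo<hi)

      above-partition : above i c (S⁻ ++ S⁺) ≡ S⁺
      above-partition = begin
        above i c (S⁻ ++ S⁺)         ≡⟨ filter-++ (λ b → c ℚₚ.≤? lo b i) S⁻ S⁺ ⟩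
        above i c S⁻ ++ above i c S⁺ ≡⟨ cong₂ _++_ (filter-none _ (All.map (λ {b} → below-c {b}) lowerBoxes)) (filter-all _ (All.map proj₁ upperBoxes)) ⟩
        S⁺                           ∎
        where
        open ≡-Reasoning
        below-c : ∀ {b} → hi b i ≤ c × lo b i < hi b i → ¬ (c ≤ lo b i)
        below-c (hi≤c , lo<hi) = <⇒≱ (ℚₚ.<-≤-trans lo<hi hi≤c)

      oneSide-partition : OneSide i c (S⁻ ++ S⁺)
      oneSide-partition = Allₚ.++⁺ (All.map (inj₁ ∘ proj₁) lowerBoxes) (All.map (inj₂ ∘ proj₁) upperBoxes)

    module _ (B₀ : Box d) where

      OnFacets : Contact d → Box d → Set
      OnFacets s B = ∀ j → (atLo s j ≡ true → lo B j ≡ lo B₀ j) × (atHi s j ≡ true → hi B j ≡ hi B₀ j)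

      onFacets-lowerPart : ∀ {s B i c} → OnFacets s B → OnFacets (lowerContact s i) (lowerPart B i c)
      onFacets-lowerPart {s} {B} {i} {c} on j =
        (λ lo-flag → trans (lo-lowerPart B i c j) (proj₁ (on j) lo-flag)) , hi⁻ (j Finₚ.≟ i)
        where
        hi⁻ : Dec (j ≡ i) → updateAt (atHi s) i (const false) j ≡ true → hi (lowerPart B i c) j ≡ hi B₀ j
        hi⁻ (yes refl) cleared≡true with () ← trans (sym (cleared (atHi s) i)) cleared≡true
        hi⁻ (no j≢i) hi-flag = trans (hi-lowerPart-≢ B i c j≢i) (proj₂ (on j) (trans (sym (kept (atHi s) j≢i)) hi-flag))

      onFacets-upperPart : ∀ {s B i c} → OnFacets s B → OnFacets (upperContact s i) (upperPart B i c)
      onFacets-upperPart {s} {B} {i} {c} on j =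
        lo⁺ (j Finₚ.≟ i) , (λ hi-flag → trans (hi-upperPart B i c j) (proj₂ (on j) hi-flag))
        where
        lo⁺ : Dec (j ≡ i) → updateAt (atLo s) i (const false) j ≡ true → lo (upperPart B i c) j ≡ lo B₀ j
        lo⁺ (yes refl) cleared≡true with () ← trans (sym (cleared (atLo s) i)) cleared≡true
        lo⁺ (no j≢i) lo-flag = trans (lo-upperPart-≢ B i c j≢i) (proj₁ (on j) (trans (sym (kept (atLo s) j≢i)) lo-flag))

      admissible⇒treeOf : ∀ T {B off s banned} → Spans B off T → Admissible s banned T → OnFacets s B →
                          Σ (TreeOf B (partition T off B) T) (BoundaryCuts B₀)
      admissible⇒treeOf leaf _ _ _ = leafT refl , tt
      admissible⇒treeOf (node i l r) {B} {off} {s} spans adm@(allowed , adm⁻ , adm⁺) on =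
        assemble below-partition above-partition
          (admissible⇒treeOf l spans⁻ adm⁻ (onFacets-lowerPart {s} {B} on))
          (admissible⇒treeOf r spans⁺ adm⁺ (onFacets-upperPart {s} {B} on))
        where
        open PartitionAtNode B off i l r spans
        boundary : ∀ j → j ≢ i → (lo B j ≡ lo B₀ j) ⊎ (hi B j ≡ hi B₀ j)
        boundary j j≢i with proj₂ allowed j j≢i
        ... | inj₁ lo-flag = inj₁ (proj₁ (on j) lo-flag)
        ... | inj₂ hi-flag = inj₂ (proj₂ (on j) hi-flag)
        assemble : ∀ {T⁻ T⁺} → below i c (S⁻ ++ S⁺) ≡ T⁻ → above i c (S⁻ ++ S⁺) ≡ T⁺ →
                   Σ (TreeOf B⁻ T⁻ l) (BoundaryCuts B₀) → Σ (TreeOf B⁺ T⁺ r) (BoundaryCuts B₀) →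
                   Σ (TreeOf B (S⁻ ++ S⁺) (node i l r)) (BoundaryCuts B₀)
        assemble refl refl (p⁻ , bc⁻) (p⁺ , bc⁺) =
          nodeT i c (lo<c , c<hi , oneSide-partition , TreeOf⇒IsGuillotine p⁻ , TreeOf⇒IsGuillotine p⁺)
                (highest spans adm) p⁻ p⁺ ,
          boundary , bc⁻ , bc⁺

    realized⇒admissible : ∀ {n T} → RealizedBoundary d n T → Admissible initialContact nothing T × size T ≡ n
    realized⇒admissible {T = T} ((B₀ , _ , S , p , bc) , size≡n) =
      treeOf⇒admissible B₀ p bc (λ j → ℚₚ.≤-refl , ℚₚ.≤-refl , (λ ()) , (λ ())) (rootNotBanned-nothing T) , size≡n

    admissible⇒realized : ∀ {n T} → Admissible initialContact nothing T → size T ≡ n → RealizedBoundary d n T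
    admissible⇒realized {n} {T} adm size≡n =
      (B₀ , valid , partition T 0 B₀ , admissible⇒treeOf B₀ T spans adm (λ j → (λ _ → refl) , (λ _ → refl))) , size≡n
      where
      B₀ : Box d
      B₀ = replicate d (fromℕ 0 , fromℕ (suc (size T)))
      lo≡ : ∀ j → lo B₀ j ≡ fromℕ 0
      lo≡ j = cong proj₁ (Vecₚ.lookup-replicate j _)
      hi≡ : ∀ j → hi B₀ j ≡ fromℕ (suc (size T))
      hi≡ j = cong proj₂ (Vecₚ.lookup-replicate j _)
      valid : ValidBox B₀
      valid j = subst₂ _<_ (sym (lo≡ j)) (sym (hi≡ j)) (fromℕ-mono-< (s≤s z≤n))
      spans : Spans B₀ 0 T
      spans j = ℚₚ.≤-reflexive (lo≡ j) , ℚₚ.≤-reflexive (sym (hi≡ j))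

    ∈-trees⇔realized : ∀ n T → (T ∈ trees n initialContact nothing n) ⇔ RealizedBoundary d n T
    ∈-trees⇔realized n T = mk⇔
      (λ T∈ → let adm , size≡n = trees-sound n initialContact nothing n T∈ in admissible⇒realized adm size≡n)
      (λ realized → let adm , size≡n = realized⇒admissible realized
                    in subst (λ m → T ∈ trees n initialContact nothing m) size≡n
                             (trees-complete T (ℕₚ.≤-reflexive size≡n) adm))

open Realization

open import Data.Nat using (ℕ; _≤_)
open import Data.Integer using (+_)
open import Data.Maybe using (nothing)
open import Data.Product using (Σ; _×_; _,_)
open import Relation.Binary.PropositionalEquality using (_≡_; sym)

mainTheorem6 : (d : ℕ) → 1 ≤ d → (n : ℕ) →
    Σ ℕ (λ a → BoundaryCount d n a × (+ a ≡ G₀ d n))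
mainTheorem6 d _ n =
  u d d n ,
  (trees n initialContact nothing n , trees-unique n initialContact nothing n ,
   ∈-trees⇔realized n , length-initialTrees n) ,
  sym (G₀≡u d n)
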